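{- Let $\Delta$ be a flag simplicial pseudomanifold of dimension $d-1$. If $\tau$ is a subset of the vertex set of $\Delta$ with $|\tau|<2d-2$, then any two vertices of $\Delta$ not in $\tau$ can be connected by a $\Delta$-strong walk in $\mathcal{G}(\Delta)\smallsetminus\tau$.
   Context: A simplicial complex is flag if every minimal non-face has at most two elements. A sequence $(\tau_0,\dots,\tau_n)$ of facets is a strong chain if $\tau_{i-1}\cap\tau_i$ is a codimension one face of both $\tau_{i-1}$ and $\tau_i$ for all $i$. Two facets are equivalent if joined by a strong chain; a strong component of a complex is the complex of all subsets of facets in one equivalence class, and a complex is strongly connected if it has a unique strong component. A $(d-1)$-dimensional simplicial complex is a pseudomanifold if it is strongly connected and each $(d-2)$-dimensional face lies in exactly two facets. $\mathcal{G}(\Delta)$ is the $1$-skeleton of $\Delta$, and $\mathcal{G}(\Delta)\smallsetminus\tau$ is obtained by deleting the vertices in $\tau$ and their incident edges. The closed star of a vertex $v$ is the subcomplex of all subsets of faces containing $v$. A walk $(v_0,e_1,v_1,\dots,e_n,v_n)$ in $\mathcal{G}(\Delta)$ (with $e_i=\{v_{i-1},v_i\}$) is $\Delta$-strong if there exist facets $\tau_1,\dots,\tau_n$ of $\Delta$ with $e_i\subseteq\tau_i$ such that $\tau_i$ and $\tau_{i+1}$ lie in the same strong component of the closed star of $v_i$ in $\Delta$ for all $1\le i\le n-1$. -}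

module Defs where

open import Level using (0ℓ)
open import Data.Nat using (ℕ; _≤_; _+_; suc)
open import Data.Fin using (Fin)
open import Data.Fin.Subset using (Subset; ⁅_⁆; _∈_; _∉_; _⊆_; _⊂_; _∩_; _∪_; ∣_∣) renaming (⊥ to ∅)
open import Data.Product using (Σ; ∃; _×_; _,_)
open import Data.Sum using (_⊎_)
open import Relation.Nullary using (¬_)
open import Relation.Binary.PropositionalEquality using (_≡_; _≢_)

-- A simplicial complex on the ground set Fin n, given by its family of faces
-- (a down-closed family of subsets containing the empty set).
-- The vertices of Δ are those v with {v} a face.
record SimplicialComplex (n : ℕ) : Set₁ where
  field
    Face        : Subset n → Set
    empty-face  : Face ∅
    down-closed : ∀ {σ ρ} → σ ⊆ ρ → Face ρ → Face σ
open SimplicialComplex public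

module _ {n : ℕ} where

  IsVertex : SimplicialComplex n → Fin n → Set
  IsVertex Δ v = Face Δ ⁅ v ⁆

  Facet : (Subset n → Set) → Subset n → Set
  Facet F σ = F σ × (∀ ρ → F ρ → σ ⊆ ρ → ρ ≡ σ)

  Codim1 : Subset n → Subset n → Set
  Codim1 σ ρ = σ ⊆ ρ × suc ∣ σ ∣ ≡ ∣ ρ ∣

  data StrongChain (F : Subset n → Set) : Subset n → Subset n → Set where
    chain-start : ∀ {σ} → Facet F σ → StrongChain F σ σ
    chain-step  : ∀ {σ ρ τ} → StrongChain F σ ρ → Facet F τ →
                  Codim1 (ρ ∩ τ) ρ → Codim1 (ρ ∩ τ) τ → StrongChain F σ τ

  SameStrongComponent : (Subset n → Set) → Subset n → Subset n → Set
  SameStrongComponent F σ τ =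
    Σ (Subset n) λ ρ₁ → Σ (Subset n) λ ρ₂ →
      σ ⊆ ρ₁ × τ ⊆ ρ₂ × StrongChain F ρ₁ ρ₂

  StronglyConnected : (Subset n → Set) → Set
  StronglyConnected F =
    (Σ (Subset n) λ σ → Facet F σ) ×
    (∀ σ τ → Facet F σ → Facet F τ → StrongChain F σ τ)

  HasDimension-1 : SimplicialComplex n → ℕ → Set
  HasDimension-1 Δ d =
    (Σ (Subset n) λ σ → Face Δ σ × ∣ σ ∣ ≡ d) ×
    (∀ σ → Face Δ σ → ∣ σ ∣ ≤ d)

  InExactlyTwoFacets : SimplicialComplex n → Subset n → Set
  InExactlyTwoFacets Δ σ =
    Σ (Subset n) λ ρ₁ → Σ (Subset n) λ ρ₂ →
      ρ₁ ≢ ρ₂ × Facet (Face Δ) ρ₁ × Facet (Face Δ) ρ₂ × σ ⊆ ρ₁ × σ ⊆ ρ₂ ×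
      (∀ ρ → Facet (Face Δ) ρ → σ ⊆ ρ → ρ ≡ ρ₁ ⊎ ρ ≡ ρ₂)

  IsPseudomanifold : SimplicialComplex n → ℕ → Set
  IsPseudomanifold Δ d =
    HasDimension-1 Δ d ×
    StronglyConnected (Face Δ) ×
    (∀ σ → Face Δ σ → suc ∣ σ ∣ ≡ d → InExactlyTwoFacets Δ σ)

  MinimalNonFace : SimplicialComplex n → Subset n → Set
  MinimalNonFace Δ σ = ¬ Face Δ σ × (∀ ρ → ρ ⊂ σ → Face Δ ρ)

  IsFlag : SimplicialComplex n → Set
  IsFlag Δ = ∀ σ → MinimalNonFace Δ σ → ∣ σ ∣ ≤ 2

  ClosedStar : SimplicialComplex n → Fin n → Subset n → Set
  ClosedStar Δ v σ = Σ (Subset n) λ ρ → Face Δ ρ × v ∈ ρ × σ ⊆ ρ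

  edge : Fin n → Fin n → Subset n
  edge u v = ⁅ u ⁆ ∪ ⁅ v ⁆

  EdgeAvoiding : SimplicialComplex n → Subset n → Fin n → Fin n → Set
  EdgeAvoiding Δ τ u v = u ≢ v × Face Δ (edge u v) × u ∉ τ × v ∉ τ

  -- StrongWalk Δ τ u v ρ : a walk of length ≥ 1 from u to v in G(Δ) ∖ τ,
  -- together with facets τ₁,…,τₘ witnessing that it is Δ-strong,
  -- whose last chosen facet τₘ is ρ.
  data StrongWalk (Δ : SimplicialComplex n) (τ : Subset n) :
         Fin n → Fin n → Subset n → Set where
    walk-edge : ∀ {u v ρ} → EdgeAvoiding Δ τ u v →
                Facet (Face Δ) ρ → edge u v ⊆ ρ → StrongWalk Δ τ u v ρ
    walk-step : ∀ {u v w ρ ρ'} → StrongWalk Δ τ u v ρ →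
                EdgeAvoiding Δ τ v w →
                Facet (Face Δ) ρ' → edge v w ⊆ ρ' →
                SameStrongComponent (ClosedStar Δ v) ρ ρ' →
                StrongWalk Δ τ u w ρ'

  -- u and v are connected by a Δ-strong walk in G(Δ) ∖ τ
  -- (the walk of length 0 when u = v)
  StronglyWalkConnected : SimplicialComplex n → Subset n → Fin n → Fin n → Set
  StronglyWalkConnected Δ τ u v =
    (u ≡ v × u ∉ τ) ⊎ (Σ (Subset n) λ ρ → StrongWalk Δ τ u v ρ)

module Submission where

-- Let Δ be a flag (d-1)-pseudomanifold and T a vertex set with ∣ T ∣ + 3 ≤ 2d.
-- Two facets form a step if they share a ridge containing a vertex outside T;
-- facets joined by steps are connected.  Along connected facets one builds
-- Δ-strong walks in G(Δ) ∖ T (Avoiding.Walks), so it suffices that live facets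
-- (facets not inside T) joined by a strong chain are connected (Bounded.connect).
-- Where the chain crosses a ridge inside T or passes through facets inside T,
-- we walk around links of faces of codimension two, which are cycles
-- (Avoiding.Link).  Each failure to get around yields a vertex of T joined to
-- most of a facet; by flagness, two such vertices found at different places
-- differ, as otherwise a ridge would lie in a third facet, and counting them
-- gives ∣ T ∣ ≥ 2d - 2 (Bounded.too-many-apices).  Finally every vertex lies in
-- a facet, found constructively by enumerating all facets (Pseudomanifold).

open import Defs
open import Data.Nat using (ℕ; zero; suc; _+_; _*_; _∸_; _^_; _≤_; _<_; z≤n; s≤s)
open import Data.Nat.Properties
  using (≤-refl; ≤-trans; ≤-reflexive; ≤-antisym; ≤-pred; <-irrefl; <-≤-trans; <⇒≤; ≰⇒>; _≤?_;
         +-comm; +-suc; +-identityʳ; +-monoʳ-≤; +-mono-≤; suc-injective; 0≢1+n; n≤1+n; m≤m+n;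
         m≤n⇒∃[o]m+o≡n; m≤o∸n⇒m+n≤o; m≤n⇒m∸n≡0; module ≤-Reasoning)
open import Data.Fin using (Fin; zero; suc; toℕ; combine)
open import Data.Fin.Properties using (any?; pigeonhole; combine-injective; <⇒≢) renaming (_≟_ to _≟F_)
open import Data.Fin.Subset using (Subset; ⁅_⁆; _∈_; _∉_; _⊆_; _⊂_; _∩_; _∪_; _─_; _-_; ∣_∣; inside; outside)
open import Data.Fin.Subset.Properties
  using (_∈?_; _⊂?_; x∈⁅x⁆; x∈⁅y⁆⇒x≡y; ∣⁅x⁆∣≡1; ∣⊥∣≡0; x∈p∪q⁺; x∈p∪q⁻; x∈p∩q⁺; x∈p∩q⁻;
         x∈p∧x∉q⇒x∈p─q; x∈p∧x≢y⇒x∈p-y; p∩q⊆p; p∩q⊆q; p─q⊆p; ∪-identityʳ; ∩-comm; drop-∷-⊆; ⊆-antisym;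
         p⊆q⇒∣p∣≤∣q∣; p⊂q⇒∣p∣<∣q∣; x∈p⇒∣p-x∣<∣p∣; nonempty?; Empty-unique)
open import Data.Bool using (Bool; true; false)
open import Data.Bool.Properties using () renaming (_≟_ to _≟B_)
open import Data.Vec using ([]; _∷_; here; there)
open import Data.Vec.Properties using (≡-dec)
open import Data.Product using (Σ; _×_; _,_; proj₁; proj₂)
open import Data.Sum using (_⊎_; inj₁; inj₂; [_,_]′; reduce)
open import Data.Empty using (⊥-elim) renaming (⊥ to False)
open import Relation.Nullary using (¬_; yes; no; ¬¬-excluded-middle)
open import Relation.Nullary.Decidable using (_×-dec_; ¬?)
open import Relation.Binary.PropositionalEquality using (_≡_; _≢_; refl; sym; trans; cong; cong₂; subst; subst₂)

private variable n : ℕ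

∈-∪ˡ : ∀ {x} {p q : Subset n} → x ∈ p → x ∈ p ∪ q
∈-∪ˡ h = x∈p∪q⁺ (inj₁ h)

∈-∪ʳ : ∀ {x} {p q : Subset n} → x ∈ q → x ∈ p ∪ q
∈-∪ʳ h = x∈p∪q⁺ (inj₂ h)

c∈p∪⁅c⁆ : ∀ {c} {p : Subset n} → c ∈ p ∪ ⁅ c ⁆
c∈p∪⁅c⁆ {c = c} = ∈-∪ʳ (x∈⁅x⁆ c)

∈-∪⁅⁆⁻ : ∀ {x c} {p : Subset n} → x ∈ p ∪ ⁅ c ⁆ → x ∈ p ⊎ x ≡ c
∈-∪⁅⁆⁻ {c = c} {p} h with x∈p∪q⁻ p ⁅ c ⁆ h
... | inj₁ x∈p = inj₁ x∈p
... | inj₂ x∈c = inj₂ (x∈⁅y⁆⇒x≡y c x∈c)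

∉-∪⁅⁆ : ∀ {x c} {p : Subset n} → x ∉ p → x ≢ c → x ∉ p ∪ ⁅ c ⁆
∉-∪⁅⁆ x∉p x≢c h with ∈-∪⁅⁆⁻ h
... | inj₁ x∈p = x∉p x∈p
... | inj₂ x≡c = x≢c x≡c

∈-─⁻ : ∀ {x} {p q : Subset n} → x ∈ p ─ q → x ∈ p × x ∉ q
∈-─⁻ {x = zero}  {inside ∷ p} {outside ∷ q} here = here , λ ()
∈-─⁻ {x = suc x} {_ ∷ p} {_ ∷ q} (there h) with ∈-─⁻ {x = x} {p} {q} h
... | x∈p , x∉q = there x∈p , λ { (there x∈q) → x∉q x∈q }

∈-minus⁻ : ∀ {x y} {p : Subset n} → x ∈ p - y → x ∈ p × x ≢ y
∈-minus⁻ h with ∈-─⁻ h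
... | x∈p , x∉y = x∈p , λ { refl → x∉y (x∈⁅x⁆ _) }

∈-minus²⁺ : ∀ {x y z} {p : Subset n} → x ∈ p → x ≢ z → x ≢ y → x ∈ (p - z) - y
∈-minus²⁺ x∈p x≢z x≢y = x∈p∧x≢y⇒x∈p-y (x∈p∧x≢y⇒x∈p-y x∈p x≢z) x≢y

∈-minus²⁻ : ∀ {x y z} {p : Subset n} → x ∈ (p - z) - y → x ∈ p
∈-minus²⁻ h = proj₁ (∈-minus⁻ (proj₁ (∈-minus⁻ h)))

minus-not : ∀ {x y} {p : Subset n} → x ∈ p → x ∉ p - y → x ≡ y
minus-not {x = x} {y} x∈p x∉p-y with x ≟F y
... | yes x≡y = x≡y
... | no x≢y = ⊥-elim (x∉p-y (x∈p∧x≢y⇒x∈p-y x∈p x≢y))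

opaque
  minus-∪-restore : ∀ {z} {p : Subset n} → z ∈ p → (p - z) ∪ ⁅ z ⁆ ≡ p
  minus-∪-restore {z = z} {p} z∈p = ⊆-antisym into onto
    where
    into : (p - z) ∪ ⁅ z ⁆ ⊆ p
    into h with ∈-∪⁅⁆⁻ h
    ... | inj₁ x∈p-z = proj₁ (∈-minus⁻ x∈p-z)
    ... | inj₂ refl = z∈p
    onto : p ⊆ (p - z) ∪ ⁅ z ⁆
    onto {x} x∈p with x ≟F z
    ... | yes refl = c∈p∪⁅c⁆
    ... | no x≢z = ∈-∪ˡ (x∈p∧x≢y⇒x∈p-y x∈p x≢z)

opaque
  card-∪-new : ∀ {x} (p : Subset n) → x ∉ p → ∣ p ∪ ⁅ x ⁆ ∣ ≡ suc ∣ p ∣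
  card-∪-new {x = zero}  (outside ∷ p) _ = cong suc (cong ∣_∣ (∪-identityʳ p))
  card-∪-new {x = zero}  (inside ∷ p) x∉p = ⊥-elim (x∉p here)
  card-∪-new {x = suc x} (outside ∷ p) x∉p = card-∪-new p (λ h → x∉p (there h))
  card-∪-new {x = suc x} (inside ∷ p) x∉p = cong suc (card-∪-new p (λ h → x∉p (there h)))

opaque
  card-split : (p q : Subset n) → q ⊆ p → ∣ p ∣ ≡ ∣ q ∣ + ∣ p ─ q ∣
  card-split []            []            _ = refl
  card-split (outside ∷ p) (outside ∷ q) q⊆p = card-split p q (drop-∷-⊆ q⊆p)
  card-split (inside ∷ p)  (outside ∷ q) q⊆p =
    trans (cong suc (card-split p q (drop-∷-⊆ q⊆p))) (sym (+-suc ∣ q ∣ ∣ p ─ q ∣))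
  card-split (inside ∷ p)  (inside ∷ q)  q⊆p = cong suc (card-split p q (drop-∷-⊆ q⊆p))
  card-split (outside ∷ p) (inside ∷ q)  q⊆p with q⊆p here
  ... | ()

opaque
  card-minus : ∀ {x} (p : Subset n) → x ∈ p → ∣ p ∣ ≡ suc ∣ p - x ∣
  card-minus {x = x} p x∈p =
    trans (card-split p ⁅ x ⁆ (λ h → subst (_∈ p) (sym (x∈⁅y⁆⇒x≡y x h)) x∈p))
          (cong (_+ ∣ p - x ∣) (∣⁅x⁆∣≡1 x))

codim1-∩-distinct : ∀ {p q : Subset n} → suc ∣ p ∩ q ∣ ≡ ∣ p ∣ → p ≢ q
codim1-∩-distinct {p = p} e refl =
  <-irrefl refl (subst (_≤ ∣ p ∩ p ∣) (sym e) (p⊆q⇒∣p∣≤∣q∣ {p = p} {q = p ∩ p} λ h → x∈p∩q⁺ (h , h)))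

opaque
  find-diff : (p q : Subset n) → (Σ (Fin n) λ c → c ∈ p × c ∉ q) ⊎ p ⊆ q
  find-diff p q with any? (λ x → (x ∈? p) ×-dec ¬? (x ∈? q))
  ... | yes witness = inj₁ witness
  ... | no none = inj₂ included
    where
    included : p ⊆ q
    included {x} x∈p with x ∈? q
    ... | yes x∈q = x∈q
    ... | no x∉q = ⊥-elim (none (x , x∈p , x∉q))

opaque
  ⊆-card-eq : ∀ {p q : Subset n} → p ⊆ q → ∣ q ∣ ≤ ∣ p ∣ → p ≡ q
  ⊆-card-eq {p = p} {q} p⊆q ∣q∣≤∣p∣ with find-diff q p
  ... | inj₂ q⊆p = ⊆-antisym p⊆q q⊆p
  ... | inj₁ (x , x∈q , x∉p) = ⊥-elim (<-irrefl refl (≤-trans (p⊂q⇒∣p∣<∣q∣ (p⊆q , x , x∈q , x∉p)) ∣q∣≤∣p∣))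

opaque
  one-point-extension : ∀ {p q : Subset n} → p ⊆ q → ∣ q ∣ ≡ suc ∣ p ∣ →
    Σ (Fin n) λ c → c ∈ q × c ∉ p × q ≡ p ∪ ⁅ c ⁆
  one-point-extension {p = p} {q} p⊆q ∣q∣≡1+∣p∣ with find-diff q p
  ... | inj₂ q⊆p = ⊥-elim (<-irrefl refl (≤-trans (≤-reflexive (sym ∣q∣≡1+∣p∣)) (p⊆q⇒∣p∣≤∣q∣ q⊆p)))
  ... | inj₁ (c , c∈q , c∉p) = c , c∈q , c∉p , sym (⊆-card-eq p∪c⊆q ∣q∣≤∣p∪c∣)
    where
    p∪c⊆q : p ∪ ⁅ c ⁆ ⊆ q
    p∪c⊆q h with ∈-∪⁅⁆⁻ h
    ... | inj₁ x∈p = p⊆q x∈p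
    ... | inj₂ refl = c∈q
    ∣q∣≤∣p∪c∣ : ∣ q ∣ ≤ ∣ p ∪ ⁅ c ⁆ ∣
    ∣q∣≤∣p∪c∣ = ≤-reflexive (trans ∣q∣≡1+∣p∣ (sym (card-∪-new p c∉p)))

opaque
  injection-card : ∀ (k : ℕ) (a s : Subset n) → ∣ a ∣ ≡ k →
    (f : ∀ x → x ∈ a → Fin n) → (∀ x x∈a → f x x∈a ∈ s) →
    (∀ x y x∈a y∈a → f x x∈a ≡ f y y∈a → x ≡ y) → ∣ a ∣ ≤ ∣ s ∣
  injection-card zero a s ∣a∣≡0 f f∈s f-inj = subst (_≤ ∣ s ∣) (sym ∣a∣≡0) z≤n
  injection-card {n} (suc k) a s ∣a∣≡k+1 f f∈s f-inj with nonempty? a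
  ... | no empty =
    ⊥-elim (0≢1+n (trans (sym (∣⊥∣≡0 n)) (trans (cong ∣_∣ (sym (Empty-unique empty))) ∣a∣≡k+1)))
  ... | yes (x , x∈a) = subst₂ _≤_ (sym (card-minus a x∈a)) (sym (card-minus s (f∈s x x∈a))) (s≤s smaller)
    where
    smaller : ∣ a - x ∣ ≤ ∣ s - f x x∈a ∣
    smaller = injection-card k (a - x) (s - f x x∈a)
      (suc-injective (trans (sym (card-minus a x∈a)) ∣a∣≡k+1))
      (λ y h → f y (proj₁ (∈-minus⁻ h)))
      (λ y h → x∈p∧x≢y⇒x∈p-y (f∈s y _) λ fy≡fx → proj₂ (∈-minus⁻ h) (f-inj y x _ x∈a fy≡fx))
      (λ y z _ _ → f-inj y z _ _)

search : ∀ {m} {S : Set} {P : Fin m → Set} → (∀ z → S ⊎ P z) → S ⊎ (∀ z → P z)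
search {zero} h = inj₂ (λ ())
search {suc m} {P = P} h with h zero | search {P = λ z → P (suc z)} (λ z → h (suc z))
... | inj₁ s  | _       = inj₁ s
... | inj₂ _  | inj₁ s  = inj₁ s
... | inj₂ p₀ | inj₂ ps = inj₂ λ { zero → p₀ ; (suc z) → ps z }

search-in : ∀ {S : Set} {P : Fin n → Set} (a : Subset n) →
  (∀ z → z ∈ a → S ⊎ P z) → S ⊎ (∀ z → z ∈ a → P z)
search-in {S = S} {P} a h = search decide
  where
  decide : ∀ z → S ⊎ (z ∈ a → P z)
  decide z with z ∈? a
  ... | no z∉a = inj₂ (λ z∈a → ⊥-elim (z∉a z∈a))
  ... | yes z∈a with h z z∈a
  ...   | inj₁ s  = inj₁ s
  ...   | inj₂ pz = inj₂ (λ _ → pz)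

edge-⊆ : ∀ {x y} {s : Subset n} → x ∈ s → y ∈ s → edge x y ⊆ s
edge-⊆ {s = s} x∈s y∈s h with ∈-∪⁅⁆⁻ h
... | inj₁ z∈x = subst (_∈ s) (sym (x∈⁅y⁆⇒x≡y _ z∈x)) x∈s
... | inj₂ refl = y∈s

bit : Bool → Fin 2
bit false = zero
bit true  = suc zero

bit-injective : ∀ a b → bit a ≡ bit b → a ≡ b
bit-injective false false _ = refl
bit-injective true  true  _ = refl

encode : ∀ {m} → Subset m → Fin (2 ^ m)
encode []      = zero
encode (b ∷ p) = combine (bit b) (encode p)

encode-injective : ∀ {m} (p q : Subset m) → encode p ≡ encode q → p ≡ q
encode-injective []      []      _ = refl
encode-injective (a ∷ p) (b ∷ q) e with combine-injective (bit a) (encode p) (bit b) (encode q) e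
... | ea , ep = cong₂ _∷_ (bit-injective a b ea) (encode-injective p q ep)

module _ {n : ℕ} {F : Subset n → Set} where

  chain-size : ∀ {σ ρ} → StrongChain F σ ρ → ∣ σ ∣ ≡ ∣ ρ ∣
  chain-size (chain-start _) = refl
  chain-size (chain-step c _ (_ , e₁) (_ , e₂)) = trans (chain-size c) (trans (sym e₁) e₂)

  chain-end-facet : ∀ {σ ρ} → StrongChain F σ ρ → Facet F ρ
  chain-end-facet (chain-start f)      = f
  chain-end-facet (chain-step _ f _ _) = f

module Pseudomanifold {n : ℕ} (Δ : SimplicialComplex n) (d : ℕ) (pm : IsPseudomanifold Δ d) where

  IsFacet : Subset n → Set
  IsFacet = Facet (Face Δ)

  IsRidge : Subset n → Set
  IsRidge r = Face Δ r × suc ∣ r ∣ ≡ d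

  face-size≤d : ∀ σ → Face Δ σ → ∣ σ ∣ ≤ d
  face-size≤d = proj₂ (proj₁ pm)

  size-d-facet : ∀ {σ} → Face Δ σ → ∣ σ ∣ ≡ d → IsFacet σ
  size-d-facet {σ} fσ ∣σ∣≡d = fσ , λ ρ fρ σ⊆ρ →
    sym (⊆-card-eq σ⊆ρ (subst (∣ ρ ∣ ≤_) (sym ∣σ∣≡d) (face-size≤d ρ fρ)))

  base-facet : Subset n
  base-facet = proj₁ (proj₁ (proj₁ pm))

  base-facet-is-facet : IsFacet base-facet
  base-facet-is-facet = size-d-facet (proj₁ (proj₂ (proj₁ (proj₁ pm)))) (proj₂ (proj₂ (proj₁ (proj₁ pm))))

  chain-from-base : ∀ {σ} → IsFacet σ → StrongChain (Face Δ) base-facet σ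
  chain-from-base fσ = proj₂ (proj₁ (proj₂ pm)) _ _ base-facet-is-facet fσ

  strongly-connected : ∀ {σ τ} → IsFacet σ → IsFacet τ → StrongChain (Face Δ) σ τ
  strongly-connected fσ fτ = proj₂ (proj₁ (proj₂ pm)) _ _ fσ fτ

  -- facets are pure: strong chains preserve size
  facet-size : ∀ {σ} → IsFacet σ → ∣ σ ∣ ≡ d
  facet-size fσ = trans (sym (chain-size (chain-from-base fσ))) (proj₂ (proj₂ (proj₁ (proj₁ pm))))

  third-facet : ∀ {r A B H} → IsRidge r → IsFacet A → IsFacet B → r ⊆ A → r ⊆ B → A ≢ B →
    IsFacet H → r ⊆ H → H ≡ A ⊎ H ≡ B
  third-facet (fr , er) fA fB r⊆A r⊆B A≢B fH r⊆H
    with proj₂ (proj₂ pm) _ fr er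
  ... | ρ₁ , ρ₂ , _ , _ , _ , _ , _ , only with only _ fA r⊆A | only _ fB r⊆B | only _ fH r⊆H
  ... | inj₁ a | inj₁ b | _      = ⊥-elim (A≢B (trans a (sym b)))
  ... | inj₂ a | inj₂ b | _      = ⊥-elim (A≢B (trans a (sym b)))
  ... | inj₁ a | inj₂ _ | inj₁ h = inj₁ (trans h (sym a))
  ... | inj₁ _ | inj₂ b | inj₂ h = inj₂ (trans h (sym b))
  ... | inj₂ _ | inj₁ b | inj₁ h = inj₂ (trans h (sym b))
  ... | inj₂ a | inj₁ _ | inj₂ h = inj₁ (trans h (sym a))

  other-facet : ∀ {r A} → IsRidge r → IsFacet A → r ⊆ A →
    Σ (Subset n) λ B → IsFacet B × r ⊆ B × B ≢ A
  other-facet (fr , er) fA r⊆A with proj₂ (proj₂ pm) _ fr er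
  ... | ρ₁ , ρ₂ , ρ₁≢ρ₂ , f₁ , f₂ , r⊆ρ₁ , r⊆ρ₂ , only with only _ fA r⊆A
  ... | inj₁ A≡ρ₁ = ρ₂ , f₂ , r⊆ρ₂ , λ e → ρ₁≢ρ₂ (trans (sym A≡ρ₁) (sym e))
  ... | inj₂ A≡ρ₂ = ρ₁ , f₁ , r⊆ρ₁ , λ e → ρ₁≢ρ₂ (trans e A≡ρ₂)

  facet-large : ∀ {σ} → IsFacet σ → d ≤ suc ∣ σ ∣
  facet-large fσ = ≤-trans (≤-reflexive (sym (facet-size fσ))) (n≤1+n _)

  facet-minus-ridge : ∀ {σ w} → IsFacet σ → w ∈ σ → IsRidge (σ - w)
  facet-minus-ridge {σ} fσ w∈σ =
    down-closed Δ (p─q⊆p σ _) (proj₁ fσ) , trans (sym (card-minus σ w∈σ)) (facet-size fσ)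

  ridge-minus-codim2 : ∀ {r z} → IsRidge r → z ∈ r → Face Δ (r - z) × suc (suc ∣ r - z ∣) ≡ d
  ridge-minus-codim2 {r} (fr , er) z∈r = down-closed Δ (p─q⊆p r _) fr , trans (cong suc (sym (card-minus r z∈r))) er

  adjacent-codim1 : ∀ {r F G} → IsRidge r → IsFacet F → IsFacet G → r ⊆ F → r ⊆ G → F ≢ G →
    Codim1 (F ∩ G) F × Codim1 (F ∩ G) G
  adjacent-codim1 {r} {F} {G} (_ , er) fF fG r⊆F r⊆G F≢G =
    (p∩q⊆p F G , e) , (p∩q⊆q F G , trans e (trans (facet-size fF) (sym (facet-size fG))))
    where
    smaller : ∣ F ∩ G ∣ < ∣ F ∣
    smaller with find-diff F G
    ... | inj₂ F⊆G = ⊥-elim (F≢G (⊆-card-eq F⊆G (≤-reflexive (trans (facet-size fG) (sym (facet-size fF))))))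
    ... | inj₁ (x , x∈F , x∉G) = p⊂q⇒∣p∣<∣q∣ (p∩q⊆p F G , x , x∈F , λ h → x∉G (proj₂ (x∈p∩q⁻ F G h)))
    e : suc ∣ F ∩ G ∣ ≡ ∣ F ∣
    e = ≤-antisym smaller (subst (_≤ suc ∣ F ∩ G ∣) (trans er (sym (facet-size fF)))
                             (s≤s (p⊆q⇒∣p∣≤∣q∣ (λ h → x∈p∩q⁺ (r⊆F h , r⊆G h)))))

  Neighbour : Subset n → Fin n → Subset n → Set
  Neighbour σ w N = IsFacet N × (σ - w) ⊆ N × N ≢ σ

  neighbour-exists : ∀ {σ w} → IsFacet σ → w ∈ σ → Σ (Subset n) (Neighbour σ w)
  neighbour-exists {σ} fσ w∈σ with other-facet (facet-minus-ridge fσ w∈σ) fσ (p─q⊆p σ _)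
  ... | N , fN , σ-w⊆N , N≢σ = N , fN , σ-w⊆N , N≢σ

  neighbour-cases : ∀ {σ w N H} → IsFacet σ → w ∈ σ → Neighbour σ w N →
    IsFacet H → (σ - w) ⊆ H → H ≡ σ ⊎ H ≡ N
  neighbour-cases {σ} fσ w∈σ (fN , σ-w⊆N , N≢σ) =
    third-facet (facet-minus-ridge fσ w∈σ) fσ fN (p─q⊆p σ _) σ-w⊆N (λ e → N≢σ (sym e))

  neighbour-unique : ∀ {σ w N N'} → IsFacet σ → w ∈ σ → Neighbour σ w N → Neighbour σ w N' → N' ≡ N
  neighbour-unique fσ w∈σ nb (fN' , σ-w⊆N' , N'≢σ) with neighbour-cases fσ w∈σ nb fN' σ-w⊆N'
  ... | inj₁ N'≡σ = ⊥-elim (N'≢σ N'≡σ)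
  ... | inj₂ N'≡N = N'≡N

  neighbour-shape : ∀ {σ w N} → IsFacet σ → w ∈ σ → Neighbour σ w N →
    Σ (Fin n) λ w' → w' ∉ σ × N ≡ (σ - w) ∪ ⁅ w' ⁆
  neighbour-shape {σ} {w} {N} fσ w∈σ (fN , σ-w⊆N , N≢σ)
    with one-point-extension σ-w⊆N (trans (facet-size fN) (sym (proj₂ (facet-minus-ridge fσ w∈σ))))
  ... | w' , w'∈N , w'∉σ-w , N≡ = w' , w'∉σ , N≡
    where
    w'∉σ : w' ∉ σ
    w'∉σ w'∈σ = N≢σ (sym (⊆-card-eq σ⊆N (≤-reflexive (trans (facet-size fN) (sym (facet-size fσ))))))
      where
      σ⊆N : σ ⊆ N
      σ⊆N {x} x∈σ with x ≟F w
      ... | yes refl = subst (_∈ N) (minus-not w'∈σ w'∉σ-w) w'∈N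
      ... | no x≢w = σ-w⊆N (x∈p∧x≢y⇒x∈p-y x∈σ x≢w)

  codim1-neighbour : ∀ {ρ τ} → IsFacet τ → Codim1 (ρ ∩ τ) ρ → Σ (Fin n) λ w → w ∈ ρ × Neighbour ρ w τ
  codim1-neighbour {ρ} {τ} fτ (ρ∩τ⊆ρ , e) with one-point-extension ρ∩τ⊆ρ (sym e)
  ... | w , w∈ρ , w∉ρ∩τ , ρ≡ = w , w∈ρ , fτ , ρ-w⊆τ , τ≢ρ
    where
    ρ-w⊆τ : ρ - w ⊆ τ
    ρ-w⊆τ {x} h with ∈-minus⁻ h
    ... | x∈ρ , x≢w with ∈-∪⁅⁆⁻ (subst (x ∈_) ρ≡ x∈ρ)
    ...   | inj₁ x∈ρ∩τ = proj₂ (x∈p∩q⁻ ρ τ x∈ρ∩τ)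
    ...   | inj₂ x≡w = ⊥-elim (x≢w x≡w)
    τ≢ρ : τ ≢ ρ
    τ≢ρ τ≡ρ = w∉ρ∩τ (x∈p∩q⁺ (w∈ρ , subst (w ∈_) (sym τ≡ρ) w∈ρ))

  -- Starting from the base facet we add unlisted
  -- neighbours one at a time; facets are distinct subsets of Fin n, so after at
  -- most 2 ^ n additions the list is closed under neighbours, and by strong
  -- connectivity it then contains every facet.
  record FacetList : Set where
    field
      size      : ℕ
      facet     : Fin size → Subset n
      is-facet  : ∀ i → IsFacet (facet i)
      injective : ∀ i j → facet i ≡ facet j → i ≡ j
      has-base  : Σ (Fin size) λ i → facet i ≡ base-facet
  open FacetList

  Listed : FacetList → Subset n → Set
  Listed L σ = Σ (Fin (size L)) λ i → facet L i ≡ σ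

  ClosedList : FacetList → Set
  ClosedList L = ∀ i w → w ∈ facet L i → ∀ N → Neighbour (facet L i) w N → Listed L N

  Unlisted : FacetList → Set
  Unlisted L = Σ (Subset n) λ N → IsFacet N × (∀ i → facet L i ≢ N)

  listed? : ∀ L σ → Listed L σ ⊎ (∀ i → facet L i ≢ σ)
  listed? L σ with any? (λ i → ≡-dec _≟B_ (facet L i) σ)
  ... | yes found = inj₁ found
  ... | no none = inj₂ (λ i e → none (i , e))

  neighbour-listed : ∀ L i w → w ∈ facet L i →
    Unlisted L ⊎ (∀ N → Neighbour (facet L i) w N → Listed L N)
  neighbour-listed L i w w∈ with neighbour-exists (is-facet L i) w∈
  ... | N , nb with listed? L N
  ...   | inj₂ none = inj₁ (N , proj₁ nb , none)
  ...   | inj₁ (j , e) = inj₂ (λ N' nb' → j , trans e (sym (neighbour-unique (is-facet L i) w∈ nb nb')))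

  unlisted-or-closed : ∀ L → Unlisted L ⊎ ClosedList L
  unlisted-or-closed L with search (λ i → search-in (facet L i) (neighbour-listed L i))
  ... | inj₁ new = inj₁ new
  ... | inj₂ all = inj₂ all

  extend : ∀ L → Unlisted L → FacetList
  extend L (N , fN , new) = record
    { size = suc (size L) ; facet = facet' ; is-facet = is-facet' ; injective = injective'
    ; has-base = suc (proj₁ (has-base L)) , proj₂ (has-base L) }
    where
    facet' : Fin (suc (size L)) → Subset n
    facet' zero    = N
    facet' (suc i) = facet L i
    is-facet' : ∀ i → IsFacet (facet' i)
    is-facet' zero    = fN
    is-facet' (suc i) = is-facet L i
    injective' : ∀ i j → facet' i ≡ facet' j → i ≡ j
    injective' zero    zero    _ = refl
    injective' zero    (suc j) e = ⊥-elim (new j (sym e))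
    injective' (suc i) zero    e = ⊥-elim (new i e)
    injective' (suc i) (suc j) e = cong suc (injective L i j e)

  grow : ∀ m L → (Σ FacetList ClosedList) ⊎ (Σ FacetList λ L' → size L + m ≤ size L')
  grow zero L = inj₂ (L , ≤-reflexive (+-identityʳ _))
  grow (suc m) L with unlisted-or-closed L
  ... | inj₂ closed = inj₁ (L , closed)
  ... | inj₁ new with grow m (extend L new)
  ...   | inj₁ done = inj₁ done
  ...   | inj₂ (L' , le) = inj₂ (L' , subst (_≤ size L') (sym (+-suc (size L) m)) le)

  singleton-list : FacetList
  singleton-list = record
    { size = 1 ; facet = λ _ → base-facet ; is-facet = λ _ → base-facet-is-facet
    ; injective = λ { zero zero _ → refl } ; has-base = zero , refl }

  -- a list of more than 2 ^ n distinct subsets of Fin n is impossible, so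
  -- growing the singleton list 2 ^ n times must close it
  closed-list : Σ FacetList ClosedList
  closed-list with grow (2 ^ n) singleton-list
  ... | inj₁ done = done
  ... | inj₂ (L , too-many) with pigeonhole too-many (λ i → encode (facet L i))
  ...   | i , j , i<j , e = ⊥-elim (<⇒≢ i<j (injective L i j (encode-injective _ _ e)))

  all-facets : FacetList
  all-facets = proj₁ closed-list

  all-facets-complete : ∀ {F} → IsFacet F → Listed all-facets F
  all-facets-complete fF = along (chain-from-base fF)
    where
    along : ∀ {F} → StrongChain (Face Δ) base-facet F → Listed all-facets F
    along (chain-start _) = has-base all-facets
    along (chain-step c fτ c₁ _) with along c
    ... | i , refl with codim1-neighbour fτ c₁
    ...   | w , w∈ , nb = proj₂ closed-list i w w∈ _ nb

  -- every face lies in a facet, up to double negation: a face of size ≤ d is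
  -- either maximal or properly contained in a larger face
  ¬¬-facet-above : ∀ m σ → Face Δ σ → suc d ≤ m + ∣ σ ∣ → ¬ ¬ (Σ (Subset n) λ F → IsFacet F × σ ⊆ F)
  ¬¬-facet-above zero σ fσ room = λ _ → <-irrefl refl (≤-trans room (face-size≤d σ fσ))
  ¬¬-facet-above (suc m) σ fσ room no-facet = ¬¬-excluded-middle {A = Σ (Subset n) λ ρ → Face Δ ρ × σ ⊂ ρ} λ
    { (yes (ρ , fρ , σ⊂ρ)) → ¬¬-facet-above m ρ fρ (larger σ⊂ρ)
                               (λ { (F , fF , ρ⊆F) → no-facet (F , fF , λ h → ρ⊆F (proj₁ σ⊂ρ h)) })
    ; (no maximal) → no-facet (σ , (fσ , λ ρ fρ σ⊆ρ → equal ρ σ⊆ρ (λ σ⊂ρ → maximal (ρ , fρ , σ⊂ρ))) , λ h → h) }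
    where
    larger : ∀ {ρ} → σ ⊂ ρ → suc d ≤ m + ∣ ρ ∣
    larger {ρ} σ⊂ρ = ≤-trans room (subst (λ k → k ≤ m + ∣ ρ ∣) (+-suc m ∣ σ ∣) (+-monoʳ-≤ m (p⊂q⇒∣p∣<∣q∣ σ⊂ρ)))
    equal : ∀ ρ → σ ⊆ ρ → ¬ σ ⊂ ρ → ρ ≡ σ
    equal ρ σ⊆ρ not-proper with find-diff ρ σ
    ... | inj₂ ρ⊆σ = ⊆-antisym ρ⊆σ σ⊆ρ
    ... | inj₁ (x , x∈ρ , x∉σ) = ⊥-elim (not-proper (σ⊆ρ , x , x∈ρ , x∉σ))

  vertex-in-facet : ∀ {u} → IsVertex Δ u → Σ (Subset n) λ F → IsFacet F × u ∈ F
  vertex-in-facet {u} u-vertex with any? (λ i → u ∈? facet all-facets i)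
  ... | yes (i , u∈) = facet all-facets i , is-facet all-facets i , u∈
  ... | no none = ⊥-elim (¬¬-facet-above (suc d) ⁅ u ⁆ u-vertex (m≤m+n (suc d) _) λ
          { (F , fF , u⊆F) → let (i , e) = all-facets-complete fF
                             in none (i , subst (u ∈_) (sym e) (u⊆F (x∈⁅x⁆ u))) })

¬¬-∀-subset : ∀ {m} {P : Subset m → Set} → (∀ p → ¬ ¬ P p) → ¬ ¬ (∀ p → P p)
¬¬-∀-subset {zero} h k = h [] (λ p → k (λ { [] → p }))
¬¬-∀-subset {suc m} {P} h k =
  ¬¬-∀-subset {P = λ p → P (true ∷ p)} (λ p → h (true ∷ p)) λ all-in →
  ¬¬-∀-subset {P = λ p → P (false ∷ p)} (λ p → h (false ∷ p)) λ all-out →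
  k (λ { (true ∷ p) → all-in p ; (false ∷ p) → all-out p })

-- In a flag complex every clique of the 1-skeleton is a face.  Faces are not
-- decidable, so this holds up to double negation, which suffices to refute
-- the existence of forbidden configurations.
module Flag {n : ℕ} (Δ : SimplicialComplex n) (flag : IsFlag Δ) where

  Clique : Subset n → Set
  Clique σ = ∀ {x y} → x ∈ σ → y ∈ σ → Face Δ (edge x y)

  face-clique : ∀ {σ} → Face Δ σ → Clique σ
  face-clique fσ x∈σ y∈σ = down-closed Δ (edge-⊆ x∈σ y∈σ) fσ

  clique-extend : ∀ {σ c} → Clique σ → Face Δ ⁅ c ⁆ → (∀ {x} → x ∈ σ → Face Δ (edge x c)) →
    Clique (σ ∪ ⁅ c ⁆)
  clique-extend {c = c} cl fc adj hx hy with ∈-∪⁅⁆⁻ hx | ∈-∪⁅⁆⁻ hy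
  ... | inj₁ x∈σ | inj₁ y∈σ = cl x∈σ y∈σ
  ... | inj₁ x∈σ | inj₂ refl = adj x∈σ
  ... | inj₂ refl | inj₁ y∈σ = down-closed Δ (edge-⊆ c∈p∪⁅c⁆ (∈-∪ˡ (x∈⁅x⁆ _))) (adj y∈σ)
  ... | inj₂ refl | inj₂ refl = down-closed Δ (edge-⊆ (x∈⁅x⁆ c) (x∈⁅x⁆ c)) fc

  small-clique-face : ∀ σ → ∣ σ ∣ ≤ 2 → Clique σ → Face Δ σ
  small-clique-face σ ∣σ∣≤2 cl with nonempty? σ
  ... | no empty = subst (Face Δ) (sym (Empty-unique empty)) (empty-face Δ)
  ... | yes (x , x∈σ) with nonempty? (σ - x)
  ...   | no empty = down-closed Δ σ⊆xx (cl x∈σ x∈σ)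
    where
    σ⊆xx : σ ⊆ edge x x
    σ⊆xx {z} z∈σ with z ≟F x
    ... | yes refl = ∈-∪ˡ (x∈⁅x⁆ z)
    ... | no z≢x = ⊥-elim (empty (z , x∈p∧x≢y⇒x∈p-y z∈σ z≢x))
  ...   | yes (y , y∈σ-x) with nonempty? (σ - x - y)
  ...     | yes (w , w∈) = ⊥-elim (<-irrefl refl (≤-trans three ∣σ∣≤2))
    where
    three : 3 ≤ ∣ σ ∣
    three = ≤-trans (s≤s (s≤s (≤-trans (s≤s z≤n) (x∈p⇒∣p-x∣<∣p∣ w∈))))
                    (≤-trans (s≤s (x∈p⇒∣p-x∣<∣p∣ y∈σ-x)) (x∈p⇒∣p-x∣<∣p∣ x∈σ))
  ...     | no empty = down-closed Δ σ⊆xy (cl x∈σ (proj₁ (∈-minus⁻ y∈σ-x)))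
    where
    σ⊆xy : σ ⊆ edge x y
    σ⊆xy {z} z∈σ with z ≟F x | z ≟F y
    ... | yes refl | _ = ∈-∪ˡ (x∈⁅x⁆ z)
    ... | no _ | yes refl = ∈-∪ʳ (x∈⁅x⁆ z)
    ... | no z≢x | no z≢y = ⊥-elim (empty (z , ∈-minus²⁺ z∈σ z≢x z≢y))

  -- induction on the size: a clique all of whose proper subsets are faces is a
  -- face, since otherwise it is a minimal non-face with more than two vertices
  clique-face-bounded : ∀ k σ → ∣ σ ∣ ≤ k → Clique σ → ¬ ¬ Face Δ σ
  clique-face-bounded k σ ∣σ∣≤k cl not-face =
    ¬¬-∀-subset (proper-faces k ∣σ∣≤k) λ all → not-face (small-clique-face σ (flag σ (not-face , all)) cl)
    where
    proper-faces : ∀ k → ∣ σ ∣ ≤ k → ∀ ρ → ¬ ¬ (ρ ⊂ σ → Face Δ ρ)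
    proper-faces k ∣σ∣≤k ρ refute with ρ ⊂? σ
    proper-faces k ∣σ∣≤k ρ refute | no ρ⊄σ = refute (λ ρ⊂σ → ⊥-elim (ρ⊄σ ρ⊂σ))
    proper-faces zero ∣σ∣≤0 ρ refute | yes ρ⊂σ = <-irrefl refl (<-≤-trans (p⊂q⇒∣p∣<∣q∣ ρ⊂σ) (≤-trans ∣σ∣≤0 z≤n))
    proper-faces (suc k) ∣σ∣≤k ρ refute | yes ρ⊂σ =
      clique-face-bounded k ρ (≤-pred (≤-trans (p⊂q⇒∣p∣<∣q∣ ρ⊂σ) ∣σ∣≤k))
        (λ x∈ρ y∈ρ → cl (proj₁ ρ⊂σ x∈ρ) (proj₁ ρ⊂σ y∈ρ)) (λ fρ → refute (λ _ → fρ))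

  clique-face : ∀ σ → Clique σ → ¬ ¬ Face Δ σ
  clique-face σ = clique-face-bounded ∣ σ ∣ σ ≤-refl

module Avoiding {n : ℕ} (Δ : SimplicialComplex n) (d : ℕ) (pm : IsPseudomanifold Δ d) (T : Subset n) where
  open Pseudomanifold Δ d pm

  Live : Subset n → Set
  Live F = Σ (Fin n) λ v → v ∈ F × v ∉ T

  not-live : ∀ {F} → F ⊆ T → ¬ Live F
  not-live F⊆T (v , v∈F , v∉T) = v∉T (F⊆T v∈F)

  live-or-inside : ∀ F → Live F ⊎ F ⊆ T
  live-or-inside F = find-diff F T

  inside≢outside : ∀ {c y} → c ∈ T → y ∉ T → c ≢ y
  inside≢outside c∈T y∉T c≡y = y∉T (subst (_∈ T) c≡y c∈T)

  live-extension : ∀ {r x F} → r ⊆ T → F ≡ r ∪ ⁅ x ⁆ → Live F → x ∉ T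
  live-extension r⊆T F≡ (v , v∈F , v∉T) with ∈-∪⁅⁆⁻ (subst (v ∈_) F≡ v∈F)
  ... | inj₁ v∈r = ⊥-elim (v∉T (r⊆T v∈r))
  ... | inj₂ v≡x = subst (_∉ T) v≡x v∉T

  Step : Subset n → Subset n → Set
  Step F G = IsFacet F × IsFacet G × Codim1 (F ∩ G) F × Codim1 (F ∩ G) G ×
             Σ (Fin n) λ y → y ∈ F × y ∈ G × y ∉ T

  step-sym : ∀ {F G} → Step F G → Step G F
  step-sym {F} {G} (fF , fG , c₁ , c₂ , y , y∈F , y∈G , y∉T) rewrite ∩-comm F G =
    fG , fF , c₂ , c₁ , y , y∈G , y∈F , y∉T

  ridge-step : ∀ {r F G y} → IsRidge r → IsFacet F → IsFacet G → r ⊆ F → r ⊆ G → F ≢ G →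
    y ∈ r → y ∉ T → Step F G
  ridge-step rr fF fG r⊆F r⊆G F≢G y∈r y∉T with adjacent-codim1 rr fF fG r⊆F r⊆G F≢G
  ... | c₁ , c₂ = fF , fG , c₁ , c₂ , _ , r⊆F y∈r , r⊆G y∈r , y∉T

  data Connected : Subset n → Subset n → Set where
    stay : ∀ {F} → Connected F F
    step : ∀ {F G H} → Step F G → Connected G H → Connected F H

  connected-≡ : ∀ {F G} → F ≡ G → Connected F G
  connected-≡ refl = stay

  connected-trans : ∀ {F G H} → Connected F G → Connected G H → Connected F H
  connected-trans stay q = q
  connected-trans (step s p) q = step s (connected-trans p q)

  connected-sym : ∀ {F G} → Connected F G → Connected G F
  connected-sym stay = stay
  connected-sym (step s p) = connected-trans (connected-sym p) (step (step-sym s) stay)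

  connected-live : ∀ {F G} → Connected F G → Live F → Live G
  connected-live stay l = l
  connected-live (step (_ , _ , _ , _ , y , _ , y∈G , y∉T) p) _ = connected-live p (y , y∈G , y∉T)

  link-facet : Subset n → Fin n → Fin n → Subset n
  link-facet φ a b = (φ ∪ ⁅ a ⁆) ∪ ⁅ b ⁆

  ∈-link-facet⁻ : ∀ {φ x a b} → x ∈ link-facet φ a b → x ∈ φ ⊎ x ≡ a ⊎ x ≡ b
  ∈-link-facet⁻ h with ∈-∪⁅⁆⁻ h
  ... | inj₂ x≡b = inj₂ (inj₂ x≡b)
  ... | inj₁ h' with ∈-∪⁅⁆⁻ h'
  ...   | inj₁ x∈φ = inj₁ x∈φ
  ...   | inj₂ x≡a = inj₂ (inj₁ x≡a)

  φ⊆link : ∀ {φ x a b} → x ∈ φ → x ∈ link-facet φ a b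
  φ⊆link x∈φ = ∈-∪ˡ (∈-∪ˡ x∈φ)

  a∈link : ∀ {φ a b} → a ∈ link-facet φ a b
  a∈link = ∈-∪ˡ c∈p∪⁅c⁆

  b∈link : ∀ {φ a b} → b ∈ link-facet φ a b
  b∈link = c∈p∪⁅c⁆

  link-facet-swap : ∀ {φ a b} → link-facet φ a b ⊆ link-facet φ b a
  link-facet-swap h with ∈-link-facet⁻ h
  ... | inj₁ x∈φ = φ⊆link x∈φ
  ... | inj₂ (inj₁ refl) = b∈link
  ... | inj₂ (inj₂ refl) = a∈link

  -- Leaving T around the link of φ: starting from the facet φ ∪ {s, t} with
  -- s ∈ T and t ∉ T, one reaches a connected facet φ ∪ {a, c} with a ∉ T,
  -- c ∈ T, which is not the starting facet traversed backwards.
  record LinkExit (φ : Subset n) (s t : Fin n) : Set where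
    field
      a c          : Fin n
      a∉T          : a ∉ T
      c∈T          : c ∈ T
      c∉φ          : c ∉ φ
      is-facet     : IsFacet (link-facet φ a c)
      connected    : Connected (link-facet φ s t) (link-facet φ a c)
      not-reversed : a ≡ t → c ≡ s → False

  module _ {φ s t} (E : LinkExit φ s t) where
    open LinkExit E

    exit-facet : Subset n
    exit-facet = link-facet φ a c

    exit-not-inside : ∀ {σ} → σ ⊆ T → exit-facet ≢ σ
    exit-not-inside σ⊆T e = not-live σ⊆T (a , subst (a ∈_) e a∈link , a∉T)

  -- The link of a face φ of codimension two is a cycle.  The facets through φ
  -- are φ ∪ {a, b}; such a facet with an orientation is a dart (a, b).  The
  -- ridge φ ∪ {b} lies in exactly one further facet φ ∪ {b, c}, giving the next
  -- dart (b, c).  Iterating `next` returns to the start and never reverses the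
  -- orientation; consecutive facets share the vertex b, so they form a step
  -- whenever b ∉ T.
  module Link (φ : Subset n) (fφ : Face Δ φ) (eφ : suc (suc ∣ φ ∣) ≡ d) where

    ridge-at : Fin n → Subset n
    ridge-at b = φ ∪ ⁅ b ⁆

    ridge-at⊆ : ∀ {a b} → ridge-at b ⊆ link-facet φ a b
    ridge-at⊆ h with ∈-∪⁅⁆⁻ h
    ... | inj₁ x∈φ = φ⊆link x∈φ
    ... | inj₂ refl = b∈link

    ridge-at⊆' : ∀ {a b} → ridge-at a ⊆ link-facet φ a b
    ridge-at⊆' h with ∈-∪⁅⁆⁻ h
    ... | inj₁ x∈φ = φ⊆link x∈φ
    ... | inj₂ refl = a∈link

    ridge-at-ridge : ∀ {a b} → b ∉ φ → Face Δ (link-facet φ a b) → IsRidge (ridge-at b)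
    ridge-at-ridge {b = b} b∉φ f = down-closed Δ ridge-at⊆ f , trans (cong suc (card-∪-new φ b∉φ)) eφ

    record Dart : Set where
      field
        a b      : Fin n
        a∉φ      : a ∉ φ
        b∉φ      : b ∉ φ
        a≢b      : a ≢ b
        is-facet : IsFacet (link-facet φ a b)
    open Dart public

    facet : Dart → Subset n
    facet D = link-facet φ (a D) (b D)

    record _≈_ (D E : Dart) : Set where
      constructor _,_
      field
        ≈a : a D ≡ a E
        ≈b : b D ≡ b E
    open _≈_ public

    ≈-sym : ∀ {D E} → D ≈ E → E ≈ D
    ≈-sym (p , q) = sym p , sym q

    ≈-trans : ∀ {D E F} → D ≈ E → E ≈ F → D ≈ F
    ≈-trans (p , q) (r , s) = trans p r , trans q s

    dart-ridge : ∀ D → IsRidge (ridge-at (b D))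
    dart-ridge D = ridge-at-ridge (b∉φ D) (proj₁ (is-facet D))

    opaque
      turn : ∀ D → Σ (Fin n) λ c → c ∉ ridge-at (b D) ×
        IsFacet (link-facet φ (b D) c) × link-facet φ (b D) c ≢ facet D
      turn D with other-facet (dart-ridge D) (is-facet D) ridge-at⊆
      ... | G , fG , r⊆G , G≢D
        with one-point-extension r⊆G (trans (facet-size fG) (sym (proj₂ (dart-ridge D))))
      ...   | c , _ , c∉r , refl = c , c∉r , fG , G≢D

    next : Dart → Dart
    next D = record
      { a = b D ; b = c ; a∉φ = b∉φ D ; b∉φ = λ c∈φ → c∉r (∈-∪ˡ c∈φ)
      ; a≢b = λ e → c∉r (subst (_∈ ridge-at (b D)) e c∈p∪⁅c⁆)
      ; is-facet = proj₁ (proj₂ (proj₂ (turn D))) }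
      where
      c = proj₁ (turn D)
      c∉r = proj₁ (proj₂ (turn D))

    next-facet≢ : ∀ D → facet (next D) ≢ facet D
    next-facet≢ D = proj₂ (proj₂ (proj₂ (turn D)))

    next-≢-back : ∀ D → b (next D) ≢ a D
    next-≢-back D c≡a = next-facet≢ D (sym (⊆-card-eq D⊆next same-size))
      where
      D⊆next : facet D ⊆ facet (next D)
      D⊆next h with ∈-link-facet⁻ h
      ... | inj₁ x∈φ = φ⊆link x∈φ
      ... | inj₂ (inj₁ refl) = subst (_∈ facet (next D)) c≡a b∈link
      ... | inj₂ (inj₂ refl) = a∈link
      same-size : ∣ facet (next D) ∣ ≤ ∣ facet D ∣
      same-size = ≤-reflexive (trans (facet-size (is-facet (next D))) (sym (facet-size (is-facet D))))

    next-unique : ∀ D E → a E ≡ b D → b E ≢ a D → b E ≡ b (next D)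
    next-unique D E aE≡bD bE≢aD
      with third-facet (dart-ridge D) (is-facet D) (is-facet (next D)) ridge-at⊆ ridge-at⊆'
             (λ e → next-facet≢ D (sym e)) (is-facet E) r⊆E
      where
      r⊆E : ridge-at (b D) ⊆ facet E
      r⊆E h with ∈-∪⁅⁆⁻ h
      ... | inj₁ x∈φ = φ⊆link x∈φ
      ... | inj₂ refl = subst (_∈ facet E) aE≡bD a∈link
    ... | inj₁ E≡D with ∈-link-facet⁻ (subst (b E ∈_) E≡D b∈link)
    ...   | inj₁ bE∈φ = ⊥-elim (b∉φ E bE∈φ)
    ...   | inj₂ (inj₁ bE≡aD) = ⊥-elim (bE≢aD bE≡aD)
    ...   | inj₂ (inj₂ bE≡bD) = ⊥-elim (a≢b E (trans aE≡bD (sym bE≡bD)))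
    next-unique D E aE≡bD bE≢aD | inj₂ E≡next with ∈-link-facet⁻ (subst (b E ∈_) E≡next b∈link)
    ...   | inj₁ bE∈φ = ⊥-elim (b∉φ E bE∈φ)
    ...   | inj₂ (inj₁ bE≡bD) = ⊥-elim (a≢b E (trans aE≡bD (sym bE≡bD)))
    ...   | inj₂ (inj₂ bE≡c) = bE≡c

    next-cong : ∀ {D E} → D ≈ E → next D ≈ next E
    next-cong {D} {E} (p , q) = q , sym (next-unique D (next E) (sym q) (λ e → next-≢-back E (trans e p)))

    reverse : Dart → Dart
    reverse D = record { a = b D ; b = a D ; a∉φ = b∉φ D ; b∉φ = a∉φ D ; a≢b = λ e → a≢b D (sym e)
                       ; is-facet = subst IsFacet (⊆-antisym link-facet-swap link-facet-swap) (is-facet D) }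

    reverse-cong : ∀ {D E} → D ≈ E → reverse D ≈ reverse E
    reverse-cong (p , q) = q , p

    next-reverse-next : ∀ D → next (reverse (next D)) ≈ reverse D
    next-reverse-next D = refl , sym (next-unique (reverse (next D)) (reverse D) refl (λ e → next-≢-back D (sym e)))

    next-injective : ∀ {D E} → next D ≈ next E → D ≈ E
    next-injective {D} {E} h = ≈b reversed , ≈a reversed
      where
      reversed : reverse D ≈ reverse E
      reversed = ≈-trans (≈-sym (next-reverse-next D)) (≈-trans (next-cong (reverse-cong h)) (next-reverse-next E))

    next-step : ∀ D → b D ∉ T → Step (facet D) (facet (next D))
    next-step D b∉T = ridge-step (dart-ridge D) (is-facet D) (is-facet (next D)) ridge-at⊆ ridge-at⊆'
      (λ e → next-facet≢ D (sym e)) c∈p∪⁅c⁆ b∉T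

    module Orbit (D₀ : Dart) where

      orbit : ℕ → Dart
      orbit zero    = D₀
      orbit (suc k) = next (orbit k)

      -- by injectivity of next, a repetition in the orbit is a return to D₀
      back-to-start : ∀ i m → orbit i ≈ orbit (i + m) → D₀ ≈ orbit m
      back-to-start zero    m h = h
      back-to-start (suc i) m h = back-to-start i m (next-injective h)

      -- darts are determined by their endpoints, so by pigeonhole the orbit returns
      returns : Σ ℕ λ K → next (orbit K) ≈ D₀
      returns with pigeonhole (≤-refl {suc (n * n)}) (λ i → combine (a (orbit (toℕ i))) (b (orbit (toℕ i))))
      ... | i , j , i<j , e with m≤n⇒∃[o]m+o≡n i<j
      ...   | o , i+1+o≡j with combine-injective _ _ _ _ e
      ...     | p , q = o , ≈-sym (back-to-start (toℕ i) (suc o)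
                              (subst (λ m → orbit (toℕ i) ≈ orbit m)
                                     (trans (sym i+1+o≡j) (sym (+-suc (toℕ i) o))) (p , q)))

      -- the orbit never reverses the orientation of D₀: orbit (y + m) ≈ reverse (orbit y)
      -- would give orbit (y + m - 1) ≈ reverse (orbit (y + 1)), down to m ≤ 1
      reversal-shift : ∀ x y → orbit (suc x) ≈ reverse (orbit y) → orbit x ≈ reverse (orbit (suc y))
      reversal-shift x y h = ≈-sym (next-injective (≈-trans (next-reverse-next (orbit y)) (≈-sym h)))

      no-reversal : ∀ m y → ¬ (orbit (y + m) ≈ reverse (orbit y))
      no-reversal zero y h rewrite +-identityʳ y = a≢b (orbit y) (≈a h)
      no-reversal (suc zero) y h rewrite +-suc y zero | +-identityʳ y = next-≢-back (orbit y) (≈b h)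
      no-reversal (suc (suc m)) y h rewrite +-suc y (suc m) | +-suc y m =
        no-reversal m (suc y) (reversal-shift (suc (y + m)) y h)

      never-reversed : ∀ k → ¬ (orbit k ≈ reverse D₀)
      never-reversed k = no-reversal k zero

      advance : ∀ j → b (orbit j) ∉ T → Connected (facet D₀) (facet (orbit j)) →
        Connected (facet D₀) (facet (orbit (suc j)))
      advance j bj∉T cn = connected-trans cn (step (next-step (orbit j) bj∉T) stay)

      Exit : Set
      Exit = Σ ℕ λ k → b (orbit k) ∈ T × a (orbit k) ∉ T × Connected (facet D₀) (facet (orbit k))

      follow : b D₀ ∉ T → ∀ j → Exit ⊎ (b (orbit j) ∉ T × Connected (facet D₀) (facet (orbit j)))
      follow b₀∉T zero = inj₂ (b₀∉T , stay)
      follow b₀∉T (suc j) with follow b₀∉T j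
      ... | inj₁ ex = inj₁ ex
      ... | inj₂ (bj∉T , cn) with b (orbit (suc j)) ∈? T
      ...   | yes b∈T = inj₁ (suc j , b∈T , bj∉T , advance j bj∉T cn)
      ...   | no b∉T = inj₂ (b∉T , advance j bj∉T cn)

      -- starting from a ∈ T and b ∉ T the orbit must leave T, since it returns to a
      exit : a D₀ ∈ T → b D₀ ∉ T → Exit
      exit a₀∈T b₀∉T with returns
      ... | K , back with follow b₀∉T K
      ...   | inj₁ ex = ex
      ...   | inj₂ (bK∉T , _) = ⊥-elim (bK∉T (subst (_∈ T) (sym (≈a back)) a₀∈T))

    leave : ∀ D₀ → a D₀ ∈ T → b D₀ ∉ T → LinkExit φ (a D₀) (b D₀)
    leave D₀ a∈T b∉T with Orbit.exit D₀ a∈T b∉T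
    ... | k , c∈T , a∉T , cn = record
      { a = a (orbit k) ; c = b (orbit k) ; a∉T = a∉T ; c∈T = c∈T ; c∉φ = b∉φ (orbit k)
      ; is-facet = is-facet (orbit k) ; connected = cn
      ; not-reversed = λ a≡t c≡s → Orbit.never-reversed D₀ k (a≡t , c≡s) }
      where open Orbit D₀ using (orbit)

  leave-link : ∀ {φ s t} → Face Δ φ → suc (suc ∣ φ ∣) ≡ d → s ∉ φ → t ∉ φ → s ≢ t →
    IsFacet (link-facet φ s t) → s ∈ T → t ∉ T → LinkExit φ s t
  leave-link {φ} {s} {t} fφ eφ s∉φ t∉φ s≢t fF = Link.leave φ fφ eφ
    record { a = s ; b = t ; a∉φ = s∉φ ; b∉φ = t∉φ ; a≢b = s≢t ; is-facet = fF }

  facet-in-star : ∀ {F w} → IsFacet F → w ∈ F → Facet (ClosedStar Δ w) F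
  facet-in-star {F} (fF , maxF) w∈F = (F , fF , w∈F , λ h → h) , λ ρ (ρ' , fρ' , _ , ρ⊆ρ') F⊆ρ →
    ⊆-antisym (λ h → subst (_ ∈_) (maxF ρ' fρ' (λ x → ρ⊆ρ' (F⊆ρ x))) (ρ⊆ρ' h)) F⊆ρ

  facet-edge : ∀ {w x F} → IsFacet F → w ∈ F → x ∈ F → w ≢ x → w ∉ T → x ∉ T → EdgeAvoiding Δ T w x
  facet-edge fF w∈F x∈F w≢x w∉T x∉T = w≢x , down-closed Δ (edge-⊆ w∈F x∈F) (proj₁ fF) , w∉T , x∉T

  -- Connected facets yield strong walks: the invariant is that every vertex of
  -- the current facet F outside T is reached from u by a Δ-strong walk whose
  -- last facet lies in the strong component of F in the star of that vertex.
  module Walks (u : Fin n) (u∉T : u ∉ T) where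

    Reach : Fin n → Subset n → Set
    Reach w F = (w ≡ u) ⊎
      Σ (Subset n) λ ρ → StrongWalk Δ T u w ρ × SameStrongComponent (ClosedStar Δ w) ρ F

    same-component-refl : ∀ {w F} → IsFacet F → w ∈ F → SameStrongComponent (ClosedStar Δ w) F F
    same-component-refl fF w∈F = _ , _ , (λ h → h) , (λ h → h) , chain-start (facet-in-star fF w∈F)

    move : ∀ {w x F} → Reach w F → IsFacet F → w ∈ F → x ∈ F → w ≢ x → w ∉ T → x ∉ T → Reach x F
    move (inj₁ refl) fF w∈F x∈F w≢x w∉T x∉T =
      inj₂ (_ , walk-edge (facet-edge fF w∈F x∈F w≢x w∉T x∉T) fF (edge-⊆ w∈F x∈F) , same-component-refl fF x∈F)
    move (inj₂ (ρ , W , same)) fF w∈F x∈F w≢x w∉T x∉T =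
      inj₂ (_ , walk-step W (facet-edge fF w∈F x∈F w≢x w∉T x∉T) fF (edge-⊆ w∈F x∈F) same ,
            same-component-refl fF x∈F)

    -- pass from F to an adjacent facet G through w: the strong chain in the
    -- star of w is extended by G
    rotate : ∀ {w F G} → Reach w F → IsFacet F → IsFacet G → w ∈ F → w ∈ G →
      Codim1 (F ∩ G) F → Codim1 (F ∩ G) G → Reach w G
    rotate (inj₁ w≡u) _ _ _ _ _ _ = inj₁ w≡u
    rotate {w} {F} {G} (inj₂ (ρ , W , (ρ₁ , ρ₂ , ρ⊆ρ₁ , F⊆ρ₂ , chain))) fF fG w∈F w∈G c₁ c₂ =
      inj₂ (ρ , W , ρ₁ , G , ρ⊆ρ₁ , (λ h → h) , chain-step chain' (facet-in-star fG w∈G) c₁ c₂)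
      where
      ρ₂≡F : ρ₂ ≡ F
      ρ₂≡F = proj₂ (facet-in-star fF w∈F) ρ₂ (proj₁ (chain-end-facet chain)) F⊆ρ₂
      chain' : StrongChain (ClosedStar Δ w) ρ₁ F
      chain' = subst (StrongChain (ClosedStar Δ w) ρ₁) ρ₂≡F chain

    AllReached : Subset n → Set
    AllReached F = ∀ x → x ∈ F → x ∉ T → Reach x F

    -- through a step, first rotate at the shared vertex y ∉ T, then move within G
    step-reached : ∀ {F G} → Step F G → AllReached F → AllReached G
    step-reached (fF , fG , c₁ , c₂ , y , y∈F , y∈G , y∉T) reached x x∈G x∉T with y ≟F x
    ... | yes refl = rotate (reached y y∈F y∉T) fF fG y∈F y∈G c₁ c₂
    ... | no y≢x = move (rotate (reached y y∈F y∉T) fF fG y∈F y∈G c₁ c₂) fG y∈G x∈G y≢x y∉T x∉T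

    connected-reached : ∀ {F G} → Connected F G → AllReached F → AllReached G
    connected-reached stay r = r
    connected-reached (step s c) r = connected-reached c (step-reached s r)

    start-reached : ∀ {F} → IsFacet F → u ∈ F → AllReached F
    start-reached fF u∈F x x∈F x∉T with u ≟F x
    ... | yes refl = inj₁ refl
    ... | no u≢x = move (inj₁ refl) fF u∈F x∈F u≢x u∉T x∉T

    walk-from-connected : ∀ {Fu Fv v} → IsFacet Fu → u ∈ Fu → Connected Fu Fv → v ∈ Fv → v ∉ T →
      StronglyWalkConnected Δ T u v
    walk-from-connected fFu u∈Fu cn v∈Fv v∉T with connected-reached cn (start-reached fFu u∈Fu) _ v∈Fv v∉T
    ... | inj₁ v≡u = inj₁ (sym v≡u , u∉T)
    ... | inj₂ (ρ , W , _) = inj₂ (ρ , W)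

module FlagPseudomanifold {n : ℕ} (Δ : SimplicialComplex n) (d : ℕ) (pm : IsPseudomanifold Δ d)
                          (flag : IsFlag Δ) where
  open Pseudomanifold Δ d pm
  open Flag Δ flag

  -- r ∪ {c} would be a clique, hence a face with d vertices: a third facet through r
  no-apex-over-ridge : ∀ {r A B c} → IsRidge r → IsFacet A → IsFacet B → r ⊆ A → r ⊆ B → A ≢ B →
    c ∉ A → c ∉ B → Face Δ ⁅ c ⁆ → (∀ {x} → x ∈ r → Face Δ (edge x c)) → False
  no-apex-over-ridge {r} {c = c} rr fA fB r⊆A r⊆B A≢B c∉A c∉B fc joined =
    clique-face (r ∪ ⁅ c ⁆) (clique-extend (face-clique (proj₁ rr)) fc joined) λ f →
      third-facet-absurd (third-facet rr fA fB r⊆A r⊆B A≢B (size-d-facet f size) ∈-∪ˡ)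
    where
    size : ∣ r ∪ ⁅ c ⁆ ∣ ≡ d
    size = trans (card-∪-new r (λ c∈r → c∉A (r⊆A c∈r))) (proj₂ rr)
    third-facet-absurd : r ∪ ⁅ c ⁆ ≡ _ ⊎ r ∪ ⁅ c ⁆ ≡ _ → False
    third-facet-absurd (inj₁ e) = c∉A (subst (c ∈_) e c∈p∪⁅c⁆)
    third-facet-absurd (inj₂ e) = c∉B (subst (c ∈_) e c∈p∪⁅c⁆)

  -- σ ∪ {c} would be a face with d + 1 vertices
  no-apex-over-facet : ∀ {σ c} → IsFacet σ → c ∉ σ → Face Δ ⁅ c ⁆ →
    (∀ {x} → x ∈ σ → Face Δ (edge x c)) → False
  no-apex-over-facet {σ} fσ c∉σ fc joined =
    clique-face (σ ∪ ⁅ _ ⁆) (clique-extend (face-clique (proj₁ fσ)) fc joined) λ f →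
      <-irrefl refl (subst (_≤ d) (trans (card-∪-new σ c∉σ) (cong suc (facet-size fσ))) (face-size≤d _ f))

module Bounded {n : ℕ} (Δ : SimplicialComplex n) (d : ℕ) (pm : IsPseudomanifold Δ d) (flag : IsFlag Δ)
               (T : Subset n) (small : suc (suc (suc ∣ T ∣)) ≤ d + d) where
  open Pseudomanifold Δ d pm
  open FlagPseudomanifold Δ d pm flag
  open Avoiding Δ d pm T

  record Cone (S : Subset n) (w e : Fin n) : Set where
    field
      apex        : Fin n
      apex∈T      : apex ∈ T
      apex∉S      : apex ∉ S
      apex-vertex : Face Δ ⁅ apex ⁆
      joined      : ∀ {x} → x ∈ S → x ≢ w → x ≢ e → Face Δ (edge x apex)
  open Cone

  cone-merge : ∀ {S w₁ e₁ w₂ e₂} (C₁ : Cone S w₁ e₁) (C₂ : Cone S w₂ e₂) → apex C₁ ≡ apex C₂ →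
    ∀ {x} → x ∈ S → ((x ≡ w₁ ⊎ x ≡ e₁) → (x ≡ w₂ ⊎ x ≡ e₂) → False) → Face Δ (edge x (apex C₁))
  cone-merge {w₁ = w₁} {e₁} {w₂} {e₂} C₁ C₂ same {x} x∈S not-both with x ≟F w₁ | x ≟F e₁ | x ≟F w₂ | x ≟F e₂
  ... | no x≢w₁ | no x≢e₁ | _ | _ = joined C₁ x∈S x≢w₁ x≢e₁
  ... | yes x≡w₁ | _ | no x≢w₂ | no x≢e₂ = subst (λ c → Face Δ (edge x c)) (sym same) (joined C₂ x∈S x≢w₂ x≢e₂)
  ... | no _ | yes x≡e₁ | no x≢w₂ | no x≢e₂ = subst (λ c → Face Δ (edge x c)) (sym same) (joined C₂ x∈S x≢w₂ x≢e₂)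
  ... | yes x≡w₁ | _ | yes x≡w₂ | _ = ⊥-elim (not-both (inj₁ x≡w₁) (inj₁ x≡w₂))
  ... | yes x≡w₁ | _ | no _ | yes x≡e₂ = ⊥-elim (not-both (inj₁ x≡w₁) (inj₂ x≡e₂))
  ... | no _ | yes x≡e₁ | yes x≡w₂ | _ = ⊥-elim (not-both (inj₂ x≡e₁) (inj₁ x≡w₂))
  ... | no _ | yes x≡e₁ | no _ | yes x≡e₂ = ⊥-elim (not-both (inj₂ x≡e₁) (inj₂ x≡e₂))

  too-many-apices : ∀ {S A} → S ⊆ T → d ≤ suc ∣ S ∣ → d ≤ suc ∣ A ∣ →
    (c : ∀ w → w ∈ A → Fin n) → (∀ w h → c w h ∈ T) → (∀ w h → c w h ∉ S) →
    (∀ w₁ w₂ h₁ h₂ → w₁ ≢ w₂ → c w₁ h₁ ≢ c w₂ h₂) → False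
  too-many-apices {S} {A} S⊆T d≤S d≤A c c∈T c∉S distinct = <-irrefl refl (begin-strict
    suc (suc ∣ T ∣)             <⟨ small ⟩
    d + d                       ≤⟨ +-mono-≤ d≤S d≤A ⟩
    suc ∣ S ∣ + suc ∣ A ∣       ≡⟨ cong suc (+-suc ∣ S ∣ ∣ A ∣) ⟩
    suc (suc (∣ S ∣ + ∣ A ∣))   ≤⟨ s≤s (s≤s S+A≤T) ⟩
    suc (suc ∣ T ∣)             ∎)
    where
    open ≤-Reasoning
    injective : ∀ w₁ w₂ h₁ h₂ → c w₁ h₁ ≡ c w₂ h₂ → w₁ ≡ w₂
    injective w₁ w₂ h₁ h₂ e with w₁ ≟F w₂
    ... | yes w₁≡w₂ = w₁≡w₂
    ... | no w₁≢w₂ = ⊥-elim (distinct w₁ w₂ h₁ h₂ w₁≢w₂ e)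
    A≤T─S : ∣ A ∣ ≤ ∣ T ─ S ∣
    A≤T─S = injection-card ∣ A ∣ A (T ─ S) refl c (λ w h → x∈p∧x∉q⇒x∈p─q (c∈T w h) (c∉S w h)) injective
    S+A≤T : ∣ S ∣ + ∣ A ∣ ≤ ∣ T ∣
    S+A≤T = subst (∣ S ∣ + ∣ A ∣ ≤_) (sym (card-split T S S⊆T)) (+-monoʳ-≤ ∣ S ∣ A≤T─S)

  exit-cone : ∀ {φ s t S w e} (E : LinkExit φ s t) → LinkExit.c E ∉ S →
    (∀ {x} → x ∈ S → x ≢ w → x ≢ e → x ∈ φ) → Cone S w e
  exit-cone E c∉S in-φ = record
    { apex = c ; apex∈T = c∈T ; apex∉S = c∉S
    ; apex-vertex = down-closed Δ (λ h → subst (_∈ exit-facet E) (sym (x∈⁅y⁆⇒x≡y _ h)) b∈link) (proj₁ is-facet)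
    ; joined = λ x∈S x≢w x≢e → down-closed Δ (edge-⊆ (φ⊆link (in-φ x∈S x≢w x≢e)) b∈link) (proj₁ is-facet) }
    where open LinkExit E

  -- Walk around the link of r - z (z ∈ r) from ρ = r ∪ {x} through a ridge
  -- r ⊆ T: either the other facet ρ' through r is reached, or the walk leaves
  -- T at the apex of a cone over r with exception z.
  detour-around : ∀ {ρ ρ' r x z} → IsFacet ρ → IsFacet ρ' → IsRidge r → r ⊆ ρ' → ρ ≢ ρ' →
    ρ ≡ r ∪ ⁅ x ⁆ → x ∉ r → x ∉ T → r ⊆ T → z ∈ r → Connected ρ ρ' ⊎ Cone r z z
  detour-around {ρ} {ρ'} {r} {x} {z} fρ fρ' rr r⊆ρ' ρ≢ρ' ρ≡ x∉r x∉T r⊆T z∈r =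
    from-exit (leave-link (proj₁ codim2) (proj₂ codim2) (λ h → proj₂ (∈-minus⁻ h) refl) (λ h → x∉r (proj₁ (∈-minus⁻ h)))
                          (λ z≡x → x∉r (subst (_∈ r) z≡x z∈r)) (subst IsFacet (sym start≡ρ) fρ) (r⊆T z∈r) x∉T)
    where
    codim2 = ridge-minus-codim2 rr z∈r
    start≡ρ : link-facet (r - z) z x ≡ ρ
    start≡ρ = trans (cong (_∪ ⁅ x ⁆) (minus-∪-restore z∈r)) (sym ρ≡)
    r⊆ρ : r ⊆ ρ
    r⊆ρ h = subst (_ ∈_) (sym ρ≡) (∈-∪ˡ h)
    from-exit : LinkExit (r - z) z x → Connected ρ ρ' ⊎ Cone r z z
    from-exit E with c ∈? r
      where open LinkExit E
    ... | no c∉r = inj₂ (exit-cone E c∉r (λ y∈r y≢z _ → x∈p∧x≢y⇒x∈p-y y∈r y≢z))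
    ... | yes c∈r with third-facet rr fρ fρ' r⊆ρ r⊆ρ' ρ≢ρ' is-facet r⊆exit
      where
      open LinkExit E
      r⊆exit : r ⊆ exit-facet E
      r⊆exit {y} y∈r with y ≟F z
      ... | yes y≡z = subst (_∈ exit-facet E) (trans (minus-not c∈r c∉φ) (sym y≡z)) b∈link
      ... | no y≢z = φ⊆link (x∈p∧x≢y⇒x∈p-y y∈r y≢z)
    ...   | inj₂ exit≡ρ' = inj₁ (subst₂ Connected start≡ρ exit≡ρ' (LinkExit.connected E))
    ...   | inj₁ exit≡ρ with ∈-∪⁅⁆⁻ (subst (LinkExit.a E ∈_) (trans exit≡ρ ρ≡) a∈link)
    ...     | inj₁ a∈r = ⊥-elim (LinkExit.a∉T E (r⊆T a∈r))
    ...     | inj₂ a≡x = ⊥-elim (LinkExit.not-reversed E a≡x (minus-not c∈r (LinkExit.c∉φ E)))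

  -- Otherwise each
  -- z ∈ r yields a cone over r with exception z; two of them with a common apex
  -- would make it joined to all of r, so the d - 1 apices are distinct.
  detour : ∀ {ρ ρ'} → IsFacet ρ → IsFacet ρ' → Codim1 (ρ ∩ ρ') ρ → Codim1 (ρ ∩ ρ') ρ' → ρ ∩ ρ' ⊆ T →
    Live ρ → Live ρ' → Connected ρ ρ'
  detour {ρ} {ρ'} fρ fρ' (r⊆ρ , e) (r⊆ρ' , e') r⊆T lρ lρ' = conclude (search-in r around)
    where
    r = ρ ∩ ρ'
    rr : IsRidge r
    rr = down-closed Δ r⊆ρ (proj₁ fρ) , trans e (facet-size fρ)
    ρ≢ρ' : ρ ≢ ρ'
    ρ≢ρ' = codim1-∩-distinct e
    ρ-shape = one-point-extension r⊆ρ (sym e)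
    ρ'-shape = one-point-extension r⊆ρ' (sym e')
    ρ≡ : ρ ≡ r ∪ ⁅ proj₁ ρ-shape ⁆
    ρ≡ = proj₂ (proj₂ (proj₂ ρ-shape))
    ρ'≡ : ρ' ≡ r ∪ ⁅ proj₁ ρ'-shape ⁆
    ρ'≡ = proj₂ (proj₂ (proj₂ ρ'-shape))
    around : ∀ z → z ∈ r → Connected ρ ρ' ⊎ Cone r z z
    around z = detour-around fρ fρ' rr r⊆ρ' ρ≢ρ' ρ≡ (proj₁ (proj₂ (proj₂ ρ-shape))) (live-extension r⊆T ρ≡ lρ) r⊆T
    apex∉ : ∀ {F y c} → F ≡ r ∪ ⁅ y ⁆ → Live F → c ∈ T → c ∉ r → c ∉ F
    apex∉ F≡ lF c∈T c∉r = subst (_ ∉_) (sym F≡) (∉-∪⁅⁆ c∉r (inside≢outside c∈T (live-extension r⊆T F≡ lF)))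
    distinct : (cone : ∀ z → z ∈ r → Cone r z z) → ∀ z₁ z₂ h₁ h₂ → z₁ ≢ z₂ → apex (cone z₁ h₁) ≢ apex (cone z₂ h₂)
    distinct cone z₁ z₂ h₁ h₂ z₁≢z₂ same =
      no-apex-over-ridge rr fρ fρ' r⊆ρ r⊆ρ' ρ≢ρ' (apex∉ ρ≡ lρ c∈T c∉r) (apex∉ ρ'≡ lρ' c∈T c∉r) (apex-vertex C₁)
        λ y∈r → cone-merge C₁ (cone z₂ h₂) same y∈r λ y≡z₁ y≡z₂ → z₁≢z₂ (trans (sym (reduce y≡z₁)) (reduce y≡z₂))
      where
      C₁ = cone z₁ h₁
      c∈T = apex∈T C₁
      c∉r = apex∉S C₁
    d≤r : d ≤ suc ∣ r ∣
    d≤r = ≤-reflexive (sym (proj₂ rr))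
    conclude : Connected ρ ρ' ⊎ (∀ z → z ∈ r → Cone r z z) → Connected ρ ρ'
    conclude (inj₁ connected) = connected
    conclude (inj₂ cone) = ⊥-elim (too-many-apices r⊆T d≤r d≤r (λ z h → apex (cone z h)) (λ z h → apex∈T (cone z h))
                                                    (λ z h → apex∉S (cone z h)) (distinct cone))

  live-neighbour-shape : ∀ {σ w N} → IsFacet σ → σ ⊆ T → w ∈ σ → Neighbour σ w N → Live N →
    Σ (Fin n) λ w' → w' ∉ σ × w' ∉ T × N ≡ (σ - w) ∪ ⁅ w' ⁆
  live-neighbour-shape fσ σ⊆T w∈σ nb lN with neighbour-shape fσ w∈σ nb
  ... | w' , w'∉σ , N≡ = w' , w'∉σ , live-extension (λ h → σ⊆T (proj₁ (∈-minus⁻ h))) N≡ lN , N≡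

  outside-live-neighbour : ∀ {σ w N c} → IsFacet σ → σ ⊆ T → w ∈ σ → Neighbour σ w N → Live N →
    c ∈ T → c ∉ σ → c ∉ N
  outside-live-neighbour fσ σ⊆T w∈σ nb lN c∈T c∉σ with live-neighbour-shape fσ σ⊆T w∈σ nb lN
  ... | w' , _ , w'∉T , N≡ =
    subst (_ ∉_) (sym N≡) (∉-∪⁅⁆ (λ h → c∉σ (proj₁ (∈-minus⁻ h))) (inside≢outside c∈T w'∉T))

  -- Outcome of walking around the link of σ - z - y (σ ⊆ T) from the live
  -- neighbour Nz of σ: a facet G connected to Nz and live, containing
  -- σ - z - y together with a vertex c ∈ T outside σ.
  record Arc (σ : Subset n) (y z : Fin n) (Nz : Subset n) : Set where
    field
      G         : Subset n
      is-facet  : IsFacet G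
      connected : Connected Nz G
      live      : Live G
      c         : Fin n
      c∈T       : c ∈ T
      c∉σ       : c ∉ σ
      φ∪c⊆G     : ((σ - z) - y) ∪ ⁅ c ⁆ ⊆ G

  arc-cone : ∀ {σ y z Nz} → Arc σ y z Nz → Cone σ y z
  arc-cone A = record
    { apex = c ; apex∈T = c∈T ; apex∉S = c∉σ
    ; apex-vertex = down-closed Δ (λ h → φ∪c⊆G (∈-∪ʳ h)) (proj₁ is-facet)
    ; joined = λ x∈σ x≢y x≢z →
        down-closed Δ (edge-⊆ (φ∪c⊆G (∈-∪ˡ (∈-minus²⁺ x∈σ x≢z x≢y))) (φ∪c⊆G c∈p∪⁅c⁆))
                    (proj₁ is-facet) }
    where open Arc A

  -- Walking around the link of φ = σ - z - y from Nz = φ ∪ {y, z'}: the walk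
  -- leaves T at c.  It cannot do so at c = y (the facet would be σ or Nz
  -- traversed backwards); at c = z it has reached the neighbour Ny across
  -- σ - y; otherwise c ∉ σ and we have an arc.
  arc-from-exit : ∀ {σ y z z' Nz Ny} → IsFacet σ → σ ⊆ T → y ∈ σ → z ∈ σ →
    Neighbour σ z Nz → Nz ≡ (σ - z) ∪ ⁅ z' ⁆ → Neighbour σ y Ny →
    link-facet ((σ - z) - y) y z' ≡ Nz → LinkExit ((σ - z) - y) y z' → Connected Nz Ny ⊎ Arc σ y z Nz
  arc-from-exit {σ} {y} {z} {z'} {Nz} {Ny} fσ σ⊆T y∈σ z∈σ nbz Nz≡ nby start≡ E with c ≟F y | c ≟F z
    where open LinkExit E
  ... | yes c≡y | _ = ⊥-elim (not-back c≡y)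
    where
    open LinkExit E
    σ-z⊆G : σ - z ⊆ exit-facet E
    σ-z⊆G {x} h with x ≟F y
    ... | yes x≡y = subst (_∈ exit-facet E) (trans c≡y (sym x≡y)) b∈link
    ... | no x≢y = φ⊆link (x∈p∧x≢y⇒x∈p-y h x≢y)
    not-back : c ≡ y → False
    not-back c≡y with neighbour-cases fσ z∈σ nbz is-facet σ-z⊆G
    ... | inj₁ G≡σ = exit-not-inside E σ⊆T G≡σ
    ... | inj₂ G≡Nz with ∈-∪⁅⁆⁻ (subst (a ∈_) (trans G≡Nz Nz≡) a∈link)
    ...   | inj₁ a∈σ-z = a∉T (σ⊆T (proj₁ (∈-minus⁻ a∈σ-z)))
    ...   | inj₂ a≡z' = not-reversed a≡z' c≡y
  ... | no _ | yes c≡z = reached-Ny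
    where
    open LinkExit E
    σ-y⊆G : σ - y ⊆ exit-facet E
    σ-y⊆G {x} h with x ≟F z
    ... | yes x≡z = subst (_∈ exit-facet E) (trans c≡z (sym x≡z)) b∈link
    ... | no x≢z = φ⊆link (∈-minus²⁺ (proj₁ (∈-minus⁻ h)) x≢z (proj₂ (∈-minus⁻ h)))
    reached-Ny : Connected Nz Ny ⊎ Arc σ y z Nz
    reached-Ny with neighbour-cases fσ y∈σ nby is-facet σ-y⊆G
    ... | inj₁ G≡σ = ⊥-elim (exit-not-inside E σ⊆T G≡σ)
    ... | inj₂ G≡Ny = inj₁ (subst₂ Connected start≡ G≡Ny connected)
  ... | no c≢y | no c≢z = inj₂ record
    { G = exit-facet E ; is-facet = is-facet ; connected = subst (λ F → Connected F _) start≡ connected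
    ; live = a , a∈link , a∉T ; c = c ; c∈T = c∈T
    ; c∉σ = λ c∈σ → c∉φ (∈-minus²⁺ c∈σ c≢z c≢y)
    ; φ∪c⊆G = λ h → [ φ⊆link , (λ { refl → b∈link }) ]′ (∈-∪⁅⁆⁻ h) }
    where open LinkExit E

  arc-around : ∀ {σ y z Nz Ny} → IsFacet σ → σ ⊆ T → y ∈ σ → z ∈ σ → y ≢ z →
    Neighbour σ z Nz → Live Nz → Neighbour σ y Ny → Connected Nz Ny ⊎ Arc σ y z Nz
  arc-around {σ} {y} {z} {Nz} fσ σ⊆T y∈σ z∈σ y≢z nbz lNz nby =
    arc-from-exit fσ σ⊆T y∈σ z∈σ nbz Nz≡ nby start≡
      (leave-link (proj₁ codim2) (proj₂ codim2) (λ h → proj₂ (∈-minus⁻ h) refl) (λ h → z'∉σ (∈-minus²⁻ h))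
                  (λ y≡z' → z'∉σ (subst (_∈ σ) y≡z' y∈σ)) (subst IsFacet (sym start≡) (proj₁ nbz)) (σ⊆T y∈σ) z'∉T)
    where
    shape = live-neighbour-shape fσ σ⊆T z∈σ nbz lNz
    z' = proj₁ shape
    z'∉σ = proj₁ (proj₂ shape)
    z'∉T = proj₁ (proj₂ (proj₂ shape))
    Nz≡ : Nz ≡ (σ - z) ∪ ⁅ z' ⁆
    Nz≡ = proj₂ (proj₂ (proj₂ shape))
    y∈σ-z : y ∈ σ - z
    y∈σ-z = x∈p∧x≢y⇒x∈p-y y∈σ y≢z
    start≡ : link-facet ((σ - z) - y) y z' ≡ Nz
    start≡ = trans (cong (_∪ ⁅ z' ⁆) (minus-∪-restore y∈σ-z)) (sym Nz≡)
    codim2 = ridge-minus-codim2 (facet-minus-ridge fσ z∈σ) y∈σ-z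

  cone-swap : ∀ {S w e} → Cone S w e → Cone S e w
  cone-swap C = record { apex = apex C ; apex∈T = apex∈T C ; apex∉S = apex∉S C ; apex-vertex = apex-vertex C
                       ; joined = λ x∈S x≢e x≢w → joined C x∈S x≢w x≢e }

  dead-neighbour-cone : ∀ {σ w N w' e} → Neighbour σ w N → N ≡ (σ - w) ∪ ⁅ w' ⁆ → w' ∉ σ → w' ∈ T →
    Cone σ w e
  dead-neighbour-cone {σ} {w} {N} {w'} (fN , _ , _) N≡ w'∉σ w'∈T = record
    { apex = w' ; apex∈T = w'∈T ; apex∉S = w'∉σ
    ; apex-vertex = down-closed Δ (λ h → w'∈N (x∈⁅y⁆⇒x≡y _ h)) (proj₁ fN)
    ; joined = λ x∈σ x≢w _ →
        down-closed Δ (edge-⊆ (subst (_ ∈_) (sym N≡) (∈-∪ˡ (x∈p∧x≢y⇒x∈p-y x∈σ x≢w))) (w'∈N refl)) (proj₁ fN) }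
    where
    w'∈N : ∀ {x} → x ≡ w' → x ∈ N
    w'∈N refl = subst (_ ∈_) (sym N≡) c∈p∪⁅c⁆

  drop-exception : ∀ {x w e : Fin n} → x ≢ e → x ≡ w ⊎ x ≡ e → x ≡ w
  drop-exception _ (inj₁ x≡w) = x≡w
  drop-exception x≢e (inj₂ x≡e) = ⊥-elim (x≢e x≡e)

  YZCone : Subset n → Fin n → Fin n → Fin n → Set
  YZCone σ y z w = Cone σ w y ⊎ Cone σ w z

  yz-cone : ∀ {σ y z w} → YZCone σ y z w → Σ (Fin n) (Cone σ w)
  yz-cone (inj₁ C) = _ , C
  yz-cone (inj₂ C) = _ , C

  yz-apex : ∀ {σ y z w} → YZCone σ y z w → Fin n
  yz-apex C = apex (proj₂ (yz-cone C))

  -- For w = y walk from Nz around σ - z - y.  Otherwise look at the neighbour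
  -- Nw across σ - w: if its new vertex is in T it is such an apex; if Nw is
  -- live, walk from Nw around σ - w - y, and if that reaches Ny, walk from Nz
  -- around σ - z - w.
  cone-at : ∀ {σ y z Ny Nz w} → IsFacet σ → σ ⊆ T → y ∈ σ → z ∈ σ → y ≢ z →
    Neighbour σ y Ny → Neighbour σ z Nz → Live Nz → w ∈ σ → w ≢ z → Connected Ny Nz ⊎ YZCone σ y z w
  cone-at {σ} {y} {z} {Ny} {Nz} {w} fσ σ⊆T y∈σ z∈σ y≢z nby nbz lNz w∈σ w≢z with w ≟F y
  ... | yes refl = [ (λ cn → inj₁ (connected-sym cn)) , (λ A → inj₂ (inj₂ (arc-cone A))) ]′
                     (arc-around fσ σ⊆T y∈σ z∈σ y≢z nbz lNz nby)
  ... | no w≢y with neighbour-exists fσ w∈σ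
  ...   | Nw , nbw with neighbour-shape fσ w∈σ nbw | live-or-inside Nw
  ...     | w' , w'∉σ , Nw≡ | inj₂ Nw⊆T =
    inj₂ (inj₁ (dead-neighbour-cone nbw Nw≡ w'∉σ (Nw⊆T (subst (w' ∈_) (sym Nw≡) c∈p∪⁅c⁆))))
  ...     | _ | inj₁ lNw = [ via-Nw , (λ A → inj₂ (inj₁ (cone-swap (arc-cone A)))) ]′
                              (arc-around fσ σ⊆T y∈σ w∈σ (λ e → w≢y (sym e)) nbw lNw nby)
    where
    via-Nw : Connected Nw Ny → Connected Ny Nz ⊎ YZCone σ y z w
    via-Nw Nw~Ny = [ (λ Nz~Nw → inj₁ (connected-sym (connected-trans Nz~Nw Nw~Ny))) ,
                     (λ A → inj₂ (inj₂ (arc-cone A))) ]′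
                     (arc-around fσ σ⊆T w∈σ z∈σ w≢z nbz lNz nbw)

  -- a vertex of T outside σ ⊆ T joined to the ridge σ - w would give a third
  -- facet through it, besides σ and its live neighbour
  no-apex-over-live-ridge : ∀ {σ w N c} → IsFacet σ → σ ⊆ T → w ∈ σ → Neighbour σ w N → Live N →
    c ∈ T → c ∉ σ → Face Δ ⁅ c ⁆ → (∀ {x} → x ∈ σ - w → Face Δ (edge x c)) → False
  no-apex-over-live-ridge {σ} fσ σ⊆T w∈σ nb lN c∈T c∉σ =
    no-apex-over-ridge (facet-minus-ridge fσ w∈σ) fσ (proj₁ nb) (p─q⊆p σ _) (proj₁ (proj₂ nb))
      (λ e → proj₂ (proj₂ nb) (sym e)) c∉σ (outside-live-neighbour fσ σ⊆T w∈σ nb lN c∈T c∉σ)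

  -- A
  -- common apex c is joined to σ - z when both exceptions are z, and to σ - y
  -- otherwise, contradicting the live neighbour across that ridge.
  yz-apices-distinct : ∀ {σ y z Ny Nz w₁ w₂} → IsFacet σ → σ ⊆ T → y ∈ σ → z ∈ σ →
    Neighbour σ y Ny → Neighbour σ z Nz → Live Ny → Live Nz → w₁ ∈ σ - z → w₂ ∈ σ - z → w₁ ≢ w₂ →
    (C₁ : YZCone σ y z w₁) (C₂ : YZCone σ y z w₂) → yz-apex C₁ ≢ yz-apex C₂
  yz-apices-distinct {σ} {y} {z} fσ σ⊆T y∈σ z∈σ nby nbz lNy lNz h₁ h₂ w₁≢w₂ (inj₂ C₁) (inj₂ C₂) same =
    no-apex-over-live-ridge fσ σ⊆T z∈σ nbz lNz (apex∈T C₁) (apex∉S C₁) (apex-vertex C₁) λ x∈σ-z →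
      let (x∈σ , x≢z) = ∈-minus⁻ x∈σ-z in
      cone-merge C₁ C₂ same x∈σ λ p q → w₁≢w₂ (trans (sym (drop-exception x≢z p)) (drop-exception x≢z q))
  yz-apices-distinct fσ σ⊆T y∈σ z∈σ nby nbz lNy lNz h₁ h₂ w₁≢w₂ (inj₁ C₁) (inj₁ C₂) same =
    no-apex-over-live-ridge fσ σ⊆T y∈σ nby lNy (apex∈T C₁) (apex∉S C₁) (apex-vertex C₁) λ x∈σ-y →
      let (x∈σ , x≢y) = ∈-minus⁻ x∈σ-y in
      cone-merge C₁ C₂ same x∈σ λ p q → w₁≢w₂ (trans (sym (drop-exception x≢y p)) (drop-exception x≢y q))
  yz-apices-distinct fσ σ⊆T y∈σ z∈σ nby nbz lNy lNz h₁ h₂ w₁≢w₂ (inj₁ C₁) (inj₂ C₂) same =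
    no-apex-over-live-ridge fσ σ⊆T y∈σ nby lNy (apex∈T C₁) (apex∉S C₁) (apex-vertex C₁) λ x∈σ-y →
      let (x∈σ , x≢y) = ∈-minus⁻ x∈σ-y in
      cone-merge C₁ C₂ same x∈σ λ p q →
        let x≡w₁ = drop-exception x≢y p
            x≢z = λ x≡z → proj₂ (∈-minus⁻ h₁) (trans (sym x≡w₁) x≡z)
        in w₁≢w₂ (trans (sym x≡w₁) (drop-exception x≢z q))
  yz-apices-distinct fσ σ⊆T y∈σ z∈σ nby nbz lNy lNz h₁ h₂ w₁≢w₂ (inj₂ C₁) (inj₁ C₂) same =
    yz-apices-distinct fσ σ⊆T y∈σ z∈σ nby nbz lNy lNz h₂ h₁ (λ e → w₁≢w₂ (sym e)) (inj₁ C₂) (inj₂ C₁) (sym same)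

  -- Two live neighbours of a facet σ ⊆ T are connected: otherwise every vertex
  -- of σ - z carries a cone from `cone-at`, with distinct apices in T ∖ σ, and
  -- T would have at least d + (d - 1) elements.
  live-neighbours-connected : ∀ {σ y z Ny Nz} → IsFacet σ → σ ⊆ T → y ∈ σ → z ∈ σ →
    Neighbour σ y Ny → Neighbour σ z Nz → Live Ny → Live Nz → Connected Ny Nz
  live-neighbours-connected {σ} {y} {z} fσ σ⊆T y∈σ z∈σ nby nbz lNy lNz with y ≟F z
  ... | yes refl = connected-≡ (sym (neighbour-unique fσ y∈σ nby nbz))
  ... | no y≢z = conclude (search-in (σ - z) λ w h →
                   cone-at fσ σ⊆T y∈σ z∈σ y≢z nby nbz lNz (proj₁ (∈-minus⁻ h)) (proj₂ (∈-minus⁻ h)))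
    where
    d≤σ-z : d ≤ suc ∣ σ - z ∣
    d≤σ-z = ≤-reflexive (trans (sym (facet-size fσ)) (card-minus σ z∈σ))
    conclude : Connected _ _ ⊎ (∀ w → w ∈ σ - z → YZCone σ y z w) → Connected _ _
    conclude (inj₁ connected) = connected
    conclude (inj₂ cone) = ⊥-elim (too-many-apices σ⊆T (facet-large fσ) d≤σ-z (λ w h → yz-apex (cone w h))
      (λ w h → apex∈T (proj₂ (yz-cone (cone w h)))) (λ w h → apex∉S (proj₂ (yz-cone (cone w h))))
      (λ w₁ w₂ h₁ h₂ w₁≢w₂ → yz-apices-distinct fσ σ⊆T y∈σ z∈σ nby nbz lNy lNz h₁ h₂ w₁≢w₂ (cone w₁ h₁) (cone w₂ h₂)))

  record Bridge (σ σ' : Subset n) : Set where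
    field
      z          : Fin n
      Nz         : Subset n
      z∈σ        : z ∈ σ
      nbz        : Neighbour σ z Nz
      live-z     : Live Nz
      w          : Fin n
      N'         : Subset n
      w∈σ'       : w ∈ σ'
      nbw        : Neighbour σ' w N'
      live-w     : Live N'
      connected  : Connected Nz N'

  DDCone : Subset n → Fin n → Fin n → Fin n → Set
  DDCone σ y y' z = Cone σ z z ⊎ (Σ (Cone σ z y) λ C → apex C ≢ y')

  dd-cone : ∀ {σ y y' z} → DDCone σ y y' z → Σ (Fin n) (Cone σ z)
  dd-cone (inj₁ C) = _ , C
  dd-cone (inj₂ (C , _)) = _ , C

  dd-apex : ∀ {σ y y' z} → DDCone σ y y' z → Fin n
  dd-apex C = apex (proj₂ (dd-cone C))

  -- For facets σ, σ' ⊆ T adjacent across σ - y, σ' = (σ - y) ∪ {y'}, and z ∈ σ: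
  -- for z = y, y' is an apex; otherwise the neighbour Nz across σ - z is dead
  -- (its new vertex is an apex) or live, and then walking from Nz around
  -- σ - z - y leaves T at an apex c ≠ y', or at c = y' in a live neighbour of σ'.
  bridge-or-cone : ∀ {σ σ' y y' z} → IsFacet σ → σ ⊆ T → y ∈ σ → Neighbour σ y σ' →
    σ' ≡ (σ - y) ∪ ⁅ y' ⁆ → y' ∉ σ → σ' ⊆ T → z ∈ σ → Bridge σ σ' ⊎ DDCone σ y y' z
  bridge-or-cone {σ} {σ'} {y} {y'} {z} fσ σ⊆T y∈σ nby σ'≡ y'∉σ σ'⊆T z∈σ with z ≟F y
  ... | yes refl = inj₂ (inj₁ (dead-neighbour-cone nby σ'≡ y'∉σ (σ'⊆T (subst (y' ∈_) (sym σ'≡) c∈p∪⁅c⁆))))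
  ... | no z≢y with neighbour-exists fσ z∈σ
  ...   | Nz , nbz with neighbour-shape fσ z∈σ nbz | live-or-inside Nz
  ...     | z' , z'∉σ , Nz≡ | inj₂ Nz⊆T =
    inj₂ (inj₁ (dead-neighbour-cone nbz Nz≡ z'∉σ (Nz⊆T (subst (z' ∈_) (sym Nz≡) c∈p∪⁅c⁆))))
  ...     | _ | inj₁ lNz = [ (λ cn → ⊥-elim (not-live σ'⊆T (connected-live cn lNz))) , from-arc ]′
                             (arc-around fσ σ⊆T y∈σ z∈σ (λ e → z≢y (sym e)) nbz lNz nby)
    where
    from-arc : Arc σ y z Nz → Bridge σ σ' ⊎ DDCone σ y y' z
    from-arc A with Arc.c A ≟F y'
    ... | no c≢y' = inj₂ (inj₂ (cone-swap (arc-cone A) , c≢y'))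
    ... | yes c≡y' = inj₁ record
      { z = z ; Nz = Nz ; z∈σ = z∈σ ; nbz = nbz ; live-z = lNz
      ; w = z ; N' = G ; w∈σ' = subst (z ∈_) (sym σ'≡) (∈-∪ˡ (x∈p∧x≢y⇒x∈p-y z∈σ z≢y))
      ; nbw = is-facet , σ'-z⊆G , (λ G≡σ' → not-live σ'⊆T (subst Live G≡σ' live))
      ; live-w = live ; connected = connected }
      where
      open Arc A
      σ'-z⊆G : σ' - z ⊆ G
      σ'-z⊆G {x} h with ∈-minus⁻ h
      ... | x∈σ' , x≢z with ∈-∪⁅⁆⁻ (subst (x ∈_) σ'≡ x∈σ')
      ...   | inj₁ x∈σ-y = φ∪c⊆G (∈-∪ˡ (∈-minus²⁺ (proj₁ (∈-minus⁻ x∈σ-y)) x≢z (proj₂ (∈-minus⁻ x∈σ-y))))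
      ...   | inj₂ x≡y' = φ∪c⊆G (∈-∪ʳ (subst (_∈ ⁅ c ⁆) (trans c≡y' (sym x≡y')) (x∈⁅x⁆ c)))

  dd-exception : ∀ {σ y y' z x} (C : DDCone σ y y' z) → x ≢ y → x ≡ z ⊎ x ≡ proj₁ (dd-cone C) → x ≡ z
  dd-exception (inj₁ _) _ = reduce
  dd-exception (inj₂ _) x≢y = drop-exception x≢y

  dd-ridge-case : ∀ {σ σ' y y' z₁ z₂} → IsFacet σ → y ∈ σ → Neighbour σ y σ' → σ' ≡ (σ - y) ∪ ⁅ y' ⁆ →
    z₁ ≢ z₂ → (C₁ : DDCone σ y y' z₁) (C₂ : DDCone σ y y' z₂) → dd-apex C₁ ≡ dd-apex C₂ → dd-apex C₁ ≢ y' → False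
  dd-ridge-case {σ} fσ y∈σ nby σ'≡ z₁≢z₂ C₁ C₂ same c≢y' =
    no-apex-over-ridge (facet-minus-ridge fσ y∈σ) fσ (proj₁ nby) (p─q⊆p σ _) (proj₁ (proj₂ nby))
      (λ e → proj₂ (proj₂ nby) (sym e)) c∉σ c∉σ' (apex-vertex K₁) λ x∈σ-y →
        let (x∈σ , x≢y) = ∈-minus⁻ x∈σ-y in
        cone-merge K₁ K₂ same x∈σ λ p q → z₁≢z₂ (trans (sym (dd-exception C₁ x≢y p)) (dd-exception C₂ x≢y q))
    where
    K₁ = proj₂ (dd-cone C₁)
    K₂ = proj₂ (dd-cone C₂)
    c∉σ = apex∉S K₁
    c∉σ' = subst (_ ∉_) (sym σ'≡) (∉-∪⁅⁆ (λ h → c∉σ (proj₁ (∈-minus⁻ h))) c≢y')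

  -- DDCones at distinct vertices have distinct apices: with exceptions z₁ and
  -- z₂ only, a common apex would be joined to all of σ; otherwise it is not y'.
  dd-apices-distinct : ∀ {σ σ' y y' z₁ z₂} → IsFacet σ → y ∈ σ → Neighbour σ y σ' →
    σ' ≡ (σ - y) ∪ ⁅ y' ⁆ → z₁ ≢ z₂ → (C₁ : DDCone σ y y' z₁) (C₂ : DDCone σ y y' z₂) → dd-apex C₁ ≢ dd-apex C₂
  dd-apices-distinct fσ y∈σ nby σ'≡ z₁≢z₂ (inj₁ C₁) (inj₁ C₂) same =
    no-apex-over-facet fσ (apex∉S C₁) (apex-vertex C₁) λ x∈σ →
      cone-merge C₁ C₂ same x∈σ λ p q → z₁≢z₂ (trans (sym (reduce p)) (reduce q))
  dd-apices-distinct fσ y∈σ nby σ'≡ z₁≢z₂ C₁@(inj₂ (_ , c≢y')) C₂ same =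
    dd-ridge-case fσ y∈σ nby σ'≡ z₁≢z₂ C₁ C₂ same c≢y'
  dd-apices-distinct fσ y∈σ nby σ'≡ z₁≢z₂ C₁@(inj₁ _) C₂@(inj₂ (_ , c≢y')) same =
    dd-ridge-case fσ y∈σ nby σ'≡ z₁≢z₂ C₁ C₂ same (λ e → c≢y' (trans (sym same) e))

  -- Two adjacent facets σ, σ' ⊆ T have connected live neighbours: otherwise
  -- every vertex of σ carries a DDCone, with distinct apices in T ∖ σ, and T
  -- would have at least 2d elements.
  dead-neighbours-bridge : ∀ {σ σ' y} → IsFacet σ → σ ⊆ T → y ∈ σ → Neighbour σ y σ' → σ' ⊆ T → Bridge σ σ'
  dead-neighbours-bridge {σ} {σ'} {y} fσ σ⊆T y∈σ nby σ'⊆T = conclude (search-in σ around)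
    where
    shape = neighbour-shape fσ y∈σ nby
    σ'≡ : σ' ≡ (σ - y) ∪ ⁅ proj₁ shape ⁆
    σ'≡ = proj₂ (proj₂ shape)
    around : ∀ z → z ∈ σ → Bridge σ σ' ⊎ DDCone σ y (proj₁ shape) z
    around z = bridge-or-cone fσ σ⊆T y∈σ nby σ'≡ (proj₁ (proj₂ shape)) σ'⊆T
    conclude : Bridge σ σ' ⊎ (∀ z → z ∈ σ → DDCone σ y (proj₁ shape) z) → Bridge σ σ'
    conclude (inj₁ bridge) = bridge
    conclude (inj₂ cone) = ⊥-elim (too-many-apices σ⊆T (facet-large fσ) (facet-large fσ) (λ z h → dd-apex (cone z h))
      (λ z h → apex∈T (proj₂ (dd-cone (cone z h)))) (λ z h → apex∉S (proj₂ (dd-cone (cone z h))))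
      (λ z₁ z₂ h₁ h₂ z₁≢z₂ → dd-apices-distinct fσ y∈σ nby σ'≡ z₁≢z₂ (cone z₁ h₁) (cone z₂ h₂)))

  -- Invariant along a strong chain starting at a live facet Fu: the current
  -- facet is live and connected to Fu, or contained in T with a live neighbour
  -- connected to Fu.
  Invariant : Subset n → Subset n → Set
  Invariant Fu ρ = (Live ρ × Connected Fu ρ) ⊎
    (ρ ⊆ T × Σ (Fin n) λ w → Σ (Subset n) λ N → w ∈ ρ × Neighbour ρ w N × Live N × Connected Fu N)

  -- Crossing from ρ to an adjacent τ: live to dead keeps ρ as the live
  -- neighbour; live to live is a step or a detour; dead to live and dead to
  -- dead go through live neighbours of ρ (and of τ).
  invariant-step : ∀ {Fu ρ τ} → IsFacet ρ → IsFacet τ → Codim1 (ρ ∩ τ) ρ → Codim1 (ρ ∩ τ) τ →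
    Invariant Fu ρ → Invariant Fu τ
  invariant-step {Fu} {ρ} {τ} fρ fτ c₁ c₂ (inj₁ (lρ , Fu~ρ)) with live-or-inside τ
  ... | inj₂ τ⊆T with codim1-neighbour fρ (subst (λ r → Codim1 r τ) (∩-comm ρ τ) c₂)
  ...   | w , w∈τ , nb = inj₂ (τ⊆T , w , ρ , w∈τ , nb , lρ , Fu~ρ)
  invariant-step {Fu} {ρ} {τ} fρ fτ c₁ c₂ (inj₁ (lρ , Fu~ρ)) | inj₁ lτ with find-diff (ρ ∩ τ) T
  ... | inj₁ (y , y∈ρ∩τ , y∉T) = inj₁ (lτ , connected-trans Fu~ρ
          (step (fρ , fτ , c₁ , c₂ , y , proj₁ (x∈p∩q⁻ ρ τ y∈ρ∩τ) , proj₂ (x∈p∩q⁻ ρ τ y∈ρ∩τ) , y∉T) stay))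
  ... | inj₂ ρ∩τ⊆T = inj₁ (lτ , connected-trans Fu~ρ (detour fρ fτ c₁ c₂ ρ∩τ⊆T lρ lτ))
  invariant-step fρ fτ c₁ c₂ (inj₂ (ρ⊆T , w , N , w∈ρ , nbN , lN , Fu~N)) with codim1-neighbour fτ c₁ | live-or-inside _
  ... | y , y∈ρ , nbτ | inj₁ lτ =
    inj₁ (lτ , connected-trans Fu~N (live-neighbours-connected fρ ρ⊆T w∈ρ y∈ρ nbN nbτ lN lτ))
  ... | y , y∈ρ , nbτ | inj₂ τ⊆T = inj₂ (τ⊆T , w' , N' , w∈τ , nbw , live-w ,
          connected-trans Fu~N (connected-trans (live-neighbours-connected fρ ρ⊆T w∈ρ z∈σ nbN nbz lN live-z) connected))
    where open Bridge (dead-neighbours-bridge fρ ρ⊆T y∈ρ nbτ τ⊆T) renaming (w to w'; w∈σ' to w∈τ)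

  connect : ∀ {Fu Fv} → StrongChain (Face Δ) Fu Fv → Live Fu → Live Fv → Connected Fu Fv
  connect {Fu} chain lFu lFv with along chain
    where
    along : ∀ {ρ} → StrongChain (Face Δ) Fu ρ → Invariant Fu ρ
    along (chain-start _) = inj₁ (lFu , stay)
    along (chain-step c fτ c₁ c₂) = invariant-step (chain-end-facet c) fτ c₁ c₂ (along c)
  ... | inj₁ (_ , Fu~Fv) = Fu~Fv
  ... | inj₂ (Fv⊆T , _) = ⊥-elim (not-live Fv⊆T lFv)

size-bound : ∀ t d → t < 2 * d ∸ 2 → suc (suc (suc t)) ≤ d + d
size-bound t d t<2d-2 with 2 ≤? 2 * d
... | yes 2≤2d = subst₂ _≤_ (+-comm (suc t) 2) (cong (d +_) (+-identityʳ d)) (m≤o∸n⇒m+n≤o (suc t) 2≤2d t<2d-2)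
... | no 2≰2d with subst (suc t ≤_) (m≤n⇒m∸n≡0 (<⇒≤ (≰⇒> 2≰2d))) t<2d-2
...   | ()

corollary3p1 : {n : ℕ} (Δ : SimplicialComplex n) (d : ℕ) →
    IsFlag Δ → IsPseudomanifold Δ d →
    (τ : Subset n) → (∀ {x} → x ∈ τ → IsVertex Δ x) → ∣ τ ∣ < 2 * d ∸ 2 →
    (u v : Fin n) → IsVertex Δ u → IsVertex Δ v → u ∉ τ → v ∉ τ →
    StronglyWalkConnected Δ τ u v
-- Place u and v in facets; these are live and joined by a strong chain, hence
-- connected, and connected facets yield a strong walk.
corollary3p1 Δ d flag pm τ _ ∣τ∣<2d-2 u v u-vertex v-vertex u∉τ v∉τ =
  let (Fu , fFu , u∈Fu) = vertex-in-facet u-vertex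
      (Fv , fFv , v∈Fv) = vertex-in-facet v-vertex
      Fu~Fv = connect (strongly-connected fFu fFv) (u , u∈Fu , u∉τ) (v , v∈Fv , v∉τ)
  in walk-from-connected fFu u∈Fu Fu~Fv v∈Fv v∉τ
  where
  open Pseudomanifold Δ d pm
  open Avoiding Δ d pm τ
  open Walks u u∉τ
  open Bounded Δ d pm flag τ (size-bound ∣ τ ∣ d ∣τ∣<2d-2)
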